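{- For $\pi\in\Sigma_n$ the following are equivalent: (i) $\pi\in bS_n\cap sS_n$; (ii) $\pi$ is a unimodal cycle of length $n$ which does not contain three consecutive elements.
   Context: Permutations act on $[n]$; products composed right to left; $\tau_i=(i,i+1)$, $D(k,j)=\tau_k\tau_{k-1}\cdots\tau_j$ for $1\le j\le k\le n-1$. Every $\pi\ne\mathrm{Id}$ has a unique expression $\pi=D(k_1,j_1)\cdots D(k_s,j_s)$ with $1\le k_1<\dots<k_s\le n-1$, $j_a\le k_a$, whose number of letters equals the Coxeter length of $\pi$; $\pi\in bS_n$ if $\pi=\mathrm{Id}$ or each $\tau_i$ occurs at most once in this word. $\pi\in sS_n$ (segment-simple) if there is no segment $I=\{i,\dots,j\}\subseteq[n]$ with $1<|I|<n$ such that $\pi(I)$ is a segment. A cycle written $(k_1\,k_2\,\dots\,k_s)$ with $k_1$ its largest element is unimodal if $k_1>\dots>k_m<k_{m+1}<\dots<k_s$ for some $m$. A cycle contains three consecutive elements if, read cyclically, it contains $i,i+1,i+2$ or $i+2,i+1,i$ in successive positions (e.g. $(7\,4\,3\,1\,2\,5\,6)$ contains $5,6,7$). -}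

module Defs where

open import Data.Nat using (ℕ; zero; suc; _+_; _∸_; _≤_; _<_; _≡ᵇ_)
open import Data.Bool using (if_then_else_)
open import Data.Fin using (Fin; toℕ; fromℕ)
open import Data.Fin.Permutation using (Permutation′; _⟨$⟩ʳ_)
open import Data.List using (List; []; _∷_; map; concatMap; downFrom)
open import Data.List.Relation.Unary.All using (All)
open import Data.List.Relation.Unary.Linked using (Linked)
open import Data.List.Relation.Unary.Unique.Propositional using (Unique)
open import Data.Product using (Σ; _×_; _,_; ∃; ∃-syntax; proj₁; proj₂)
open import Data.Sum using (_⊎_)
open import Relation.Binary.PropositionalEquality using (_≡_)
open import Relation.Nullary using (¬_)
open import Function.Bundles using (_⇔_)

-- Throughout, [n] = {1,…,n} is modelled by Fin n, the element x : Fin n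
-- standing for the number suc (toℕ x).

τ : ℕ → ℕ → ℕ
τ i x = if x ≡ᵇ i then suc i else (if x ≡ᵇ suc i then i else x)

-- a word a₁ a₂ … a_r denotes τ_{a₁} ∘ τ_{a₂} ∘ ⋯ ∘ τ_{a_r} (right to left)
evalWord : List ℕ → ℕ → ℕ
evalWord []      x = x
evalWord (a ∷ w) x = τ a (evalWord w x)

Represents : ∀ {n} → List ℕ → Permutation′ n → Set
Represents w π = ∀ x → evalWord w (suc (toℕ x)) ≡ suc (toℕ (π ⟨$⟩ʳ x))

-- D(k,j) = τ_k τ_{k-1} ⋯ τ_j  (for j ≤ k), as the word k, k-1, …, j
D : ℕ → ℕ → List ℕ
D k j = map (j +_) (downFrom (suc (k ∸ j)))

ValidFactor : ℕ → ℕ × ℕ → Set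
ValidFactor n (k , j) = 1 ≤ j × j ≤ k × suc k ≤ n

Admissible : ℕ → List (ℕ × ℕ) → Set
Admissible n fs = All (ValidFactor n) fs × Linked _<_ (map proj₁ fs)

wordOf : List (ℕ × ℕ) → List ℕ
wordOf = concatMap (λ p → D (proj₁ p) (proj₂ p))

-- π ∈ bS_n : the (unique) canonical expression of π has each τ_i at most
-- once (π = Id corresponds to the empty list of factors)
InbS : ∀ {n} → Permutation′ n → Set
InbS {n} π = ∃[ fs ] (Admissible n fs × Represents (wordOf fs) π × Unique (wordOf fs))

InSeg : ∀ {n} → ℕ → ℕ → Fin n → Set
InSeg i j x = i ≤ suc (toℕ x) × suc (toℕ x) ≤ j

ImageIsSegment : ∀ {n} → Permutation′ n → ℕ → ℕ → Set
ImageIsSegment {n} π i j =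
  ∃[ a ] ∃[ b ] (∀ (y : Fin n) →
    (∃[ x ] (InSeg i j x × π ⟨$⟩ʳ x ≡ y)) ⇔ (a ≤ suc (toℕ y) × suc (toℕ y) ≤ b))

InsS : ∀ {n} → Permutation′ n → Set
InsS {n} π = ¬ (∃[ i ] ∃[ j ]
  (1 ≤ i × i ≤ j × j ≤ n × 1 < suc j ∸ i × suc j ∸ i < n × ImageIsSegment π i j))

iter : ∀ {n} → Permutation′ n → ℕ → Fin n → Fin n
iter π zero    x = x
iter π (suc t) x = π ⟨$⟩ʳ iter π t x

-- k_{t+1} = π^t(n) as a number in [n]  (here n = suc m)
cyc : ∀ {m} → Permutation′ (suc m) → ℕ → ℕ
cyc {m} π t = suc (toℕ (iter π t (fromℕ m)))

IsNCycle : ∀ {m} → Permutation′ (suc m) → Set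
IsNCycle {m} π = ∀ s t → s < suc m → t < suc m → cyc π s ≡ cyc π t → s ≡ t

-- the cycle (k₁ k₂ … k_n), k₁ = n, is unimodal:
-- k₁ > ⋯ > k_M < k_{M+1} < ⋯ < k_n for some M (0-based positions here)
Unimodal : ∀ {m} → Permutation′ (suc m) → Set
Unimodal {m} π = ∃[ M ] (M < suc m
  × (∀ t → suc t ≤ M → cyc π (suc t) < cyc π t)
  × (∀ t → M ≤ t → suc t < suc m → cyc π t < cyc π (suc t)))

-- read cyclically, the cycle contains i,i+1,i+2 or i+2,i+1,i in
-- successive positions (positions t, t+1, t+2 taken mod n; since
-- π^n(n) = n for an n-cycle, cyc π already reads cyclically)
ContainsThreeConsecutive : ∀ {m} → Permutation′ (suc m) → Set
ContainsThreeConsecutive {m} π = ∃[ t ] (t < suc m ×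
  ((cyc π (suc t) ≡ suc (cyc π t) × cyc π (suc (suc t)) ≡ suc (cyc π (suc t)))
   ⊎ (cyc π t ≡ suc (cyc π (suc t)) × cyc π (suc t) ≡ suc (cyc π (suc (suc t))))))

module Submission where

-- Both conditions are compared with a third one: π is the zigzag of its set U
-- of ascents on [1, n], sending each ascent to the next element of U ∪ {n} and
-- every other point to the previous element of ∁U ∪ {1}.  Such a π visits n,
-- then the non-ascents in decreasing order down to 1, then the ascents in
-- increasing order back to n: it is a unimodal n-cycle, and every unimodal
-- n-cycle has this shape.  On the word side, a missing letter i would leave
-- [1, i] invariant, so for π ∈ sS_n every letter 1, …, n − 1 occurs; if each
-- occurs once, the factors D(k_a, j_a) are forced to be the consecutive blocks
-- j₁ = 1, j_{a+1} = k_a + 1, k_s = n − 1, and their product is the zigzag of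
-- {j₁, …, j_s}.  Finally a zigzag maps a proper segment onto a segment only if
-- it contains a run x ↦ x+1 ↦ x+2 or x+2 ↦ x+1 ↦ x, i.e. three consecutive
-- elements of the cycle.

open import Defs
open import Data.Nat
open import Data.Nat.Properties
open import Data.Bool as Bool using (true; false; if_then_else_)
open import Data.Empty using (⊥; ⊥-elim)
open import Data.Fin as Fin using (Fin; toℕ; fromℕ; fromℕ<)
open import Data.Fin.Permutation using (Permutation′; _⟨$⟩ʳ_; _⟨$⟩ˡ_; inverseˡ; inverseʳ)
open import Data.Fin.Properties
  using (toℕ-injective; toℕ<n; fromℕ<-toℕ; toℕ-fromℕ<; toℕ-fromℕ; punchOut-injective; injective⇒≤; any?)
open import Data.List using (List; []; _∷_; _++_; map; downFrom)
open import Data.List.Membership.Propositional using (_∈_)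
open import Data.List.Membership.DecPropositional _≟_ using (_∈?_)
open import Data.List.Membership.Propositional.Properties using (∈-++⁺ˡ; ∈-++⁺ʳ)
open import Data.List.Relation.Unary.All as All using (All; []; _∷_)
open import Data.List.Relation.Unary.All.Properties using (++⁺)
open import Data.List.Relation.Unary.AllPairs.Properties as AllPairs using ()
open import Data.List.Relation.Unary.Any using (here; there)
open import Data.List.Relation.Unary.Linked using (Linked; [-]; _∷_)
open import Data.List.Relation.Unary.Unique.Propositional using (Unique; []; _∷_)
open import Data.Product using (Σ; _×_; _,_; ∃; ∃-syntax; proj₁; proj₂)
open import Data.Sum using (_⊎_; inj₁; inj₂)
open import Function using (_∘_)
open import Function.Bundles using (_⇔_; mk⇔; Equivalence)
open import Relation.Binary.Definitions using (tri<; tri≈; tri>)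
open import Relation.Binary.PropositionalEquality
open import Relation.Nullary using (¬_; yes; no; contradiction)
open import Relation.Nullary.Decidable using (_×-dec_; ¬?; decidable-stable)
open import Relation.Unary using (Decidable)

if-≡ᵇ-yes : ∀ {A : Set} x y {a b : A} → x ≡ y → (if x ≡ᵇ y then a else b) ≡ a
if-≡ᵇ-yes x y x≡y with x ≡ᵇ y | ≡⇒≡ᵇ x y x≡y
... | true | _ = refl

if-≡ᵇ-no : ∀ {A : Set} x y {a b : A} → x ≢ y → (if x ≡ᵇ y then a else b) ≡ b
if-≡ᵇ-no x y x≢y with x ≡ᵇ y in eq
... | true  = contradiction (≡ᵇ⇒≡ x y (subst Bool.T (sym eq) _)) x≢y
... | false = refl

τ-left : ∀ i → τ i i ≡ suc i
τ-left i = if-≡ᵇ-yes i i refl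

τ-right : ∀ i → τ i (suc i) ≡ i
τ-right i = trans (if-≡ᵇ-no (suc i) i 1+n≢n) (if-≡ᵇ-yes (suc i) (suc i) refl)

τ-fix : ∀ {i x} → x ≢ i → x ≢ suc i → τ i x ≡ x
τ-fix {i} {x} x≢i x≢1+i = trans (if-≡ᵇ-no x i x≢i) (if-≡ᵇ-no x (suc i) x≢1+i)

evalWord-++ : ∀ xs ys x → evalWord (xs ++ ys) x ≡ evalWord xs (evalWord ys x)
evalWord-++ []       ys x = refl
evalWord-++ (a ∷ xs) ys x = cong (τ a) (evalWord-++ xs ys x)

-- D(k, j) acts as the cycle (j k+1 k … j+1).
D′ : ℕ → ℕ → List ℕ
D′ j d = map (j +_) (downFrom (suc d))

evalWord-D′-start : ∀ j d → evalWord (D′ j d) j ≡ suc (j + d)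
evalWord-D′-start j zero rewrite +-identityʳ j = τ-left j
evalWord-D′-start j (suc d) = begin
  τ (j + suc d) (evalWord (D′ j d) j) ≡⟨ cong (τ (j + suc d)) (evalWord-D′-start j d) ⟩
  τ (j + suc d) (suc (j + d))         ≡⟨ cong (τ (j + suc d)) (sym (+-suc j d)) ⟩
  τ (j + suc d) (j + suc d)           ≡⟨ τ-left (j + suc d) ⟩
  suc (j + suc d)                     ∎
  where open ≡-Reasoning

evalWord-D′-above : ∀ j d x → suc (j + d) < x → evalWord (D′ j d) x ≡ x
evalWord-D′-above j zero x lt =
  τ-fix (λ eq → <⇒≢ (≤-trans (n≤1+n _) lt) (sym eq)) (λ eq → <⇒≢ lt (sym eq))
evalWord-D′-above j (suc d) x lt =
  trans (cong (τ (j + suc d)) (evalWord-D′-above j d x (≤-trans (s≤s (s≤s (+-monoʳ-≤ j (n≤1+n d)))) lt)))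
        (τ-fix (λ eq → <⇒≢ (≤-trans (n≤1+n _) lt) (sym eq)) (λ eq → <⇒≢ lt (sym eq)))

evalWord-D′-below : ∀ j d x → x < j → evalWord (D′ j d) x ≡ x
evalWord-D′-below j d x x<j = go d
  where
    go : ∀ d → evalWord (D′ j d) x ≡ x
    fixes : ∀ d → τ (j + d) x ≡ x
    fixes d = τ-fix (<⇒≢ (≤-trans x<j (m≤m+n j d)))
                    (<⇒≢ (≤-trans x<j (≤-trans (m≤m+n j d) (n≤1+n _))))
    go zero    = fixes 0
    go (suc d) = trans (cong (τ (j + suc d)) (go d)) (fixes (suc d))

evalWord-D′-suc : ∀ j d y → j ≤ y → y ≤ j + d → evalWord (D′ j d) (suc y) ≡ y
evalWord-D′-suc j zero y j≤y y≤j+0 with ≤-antisym j≤y (subst (y ≤_) (+-identityʳ j) y≤j+0)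
... | refl = trans (cong (λ i → τ i (suc j)) (+-identityʳ j)) (τ-right j)
evalWord-D′-suc j (suc d) y j≤y y≤j+d+1 with m≤n⇒m<n∨m≡n y≤j+d+1
... | inj₂ refl =
  trans (cong (τ (j + suc d)) (evalWord-D′-above j d (suc (j + suc d)) (s≤s (≤-reflexive (sym (+-suc j d))))))
        (τ-right _)
... | inj₁ lt =
  trans (cong (τ (j + suc d)) (evalWord-D′-suc j d y j≤y (≤-pred (subst (y <_) (+-suc j d) lt))))
        (τ-fix (<⇒≢ lt) (<⇒≢ (m<n⇒m<1+n lt)))

module _ {j k : ℕ} (j≤k : j ≤ k) where

  private
    j+[k∸j]≡k : j + (k ∸ j) ≡ k
    j+[k∸j]≡k = m+[n∸m]≡n j≤k

  evalWord-D-start : evalWord (D k j) j ≡ suc k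
  evalWord-D-start = trans (evalWord-D′-start j (k ∸ j)) (cong suc j+[k∸j]≡k)

  evalWord-D-suc : ∀ {y} → j ≤ y → y ≤ k → evalWord (D k j) (suc y) ≡ y
  evalWord-D-suc {y} j≤y y≤k = evalWord-D′-suc j (k ∸ j) y j≤y (subst (y ≤_) (sym j+[k∸j]≡k) y≤k)

  evalWord-D-above : ∀ {x} → suc k < x → evalWord (D k j) x ≡ x
  evalWord-D-above {x} lt = evalWord-D′-above j (k ∸ j) x (subst (λ z → suc z < x) (sym j+[k∸j]≡k) lt)

evalWord-D-below : ∀ {j k x} → x < j → evalWord (D k j) x ≡ x
evalWord-D-below {j} {k} {x} = evalWord-D′-below j (k ∸ j) x

D′-letters : ∀ j d → All (λ a → j ≤ a × a ≤ j + d) (D′ j d)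
D′-letters j zero = (m≤m+n j 0 , ≤-refl) ∷ []
D′-letters j (suc d) =
  (m≤m+n j _ , ≤-refl) ∷ All.map (λ (p , q) → p , ≤-trans q (+-monoʳ-≤ j (n≤1+n d))) (D′-letters j d)

D′-unique : ∀ j d → Unique (D′ j d)
D′-unique j zero = [] ∷ []
D′-unique j (suc d) =
  All.map (λ (_ , a≤j+d) eq → <⇒≢ (≤-trans (s≤s a≤j+d) (≤-reflexive (sym (+-suc j d)))) (sym eq))
          (D′-letters j d)
  ∷ D′-unique j d

∈-D′ : ∀ j d x → j ≤ x → x ≤ j + d → x ∈ D′ j d
∈-D′ j zero x j≤x x≤j+0 = here (≤-antisym x≤j+0 (≤-trans (≤-reflexive (+-identityʳ j)) j≤x))
∈-D′ j (suc d) x j≤x x≤j+d+1 with m≤n⇒m<n∨m≡n x≤j+d+1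
... | inj₂ eq = here eq
... | inj₁ lt = there (∈-D′ j d x j≤x (≤-pred (subst (x <_) (+-suc j d) lt)))

module _ {j k : ℕ} (j≤k : j ≤ k) where

  D-letters : All (λ a → j ≤ a × a ≤ k) (D k j)
  D-letters = subst (λ z → All (λ a → j ≤ a × a ≤ z) (D k j)) (m+[n∸m]≡n j≤k) (D′-letters j (k ∸ j))

  ∈-D : ∀ {x} → j ≤ x → x ≤ k → x ∈ D k j
  ∈-D {x} j≤x x≤k = ∈-D′ j (k ∸ j) x j≤x (subst (x ≤_) (sym (m+[n∸m]≡n j≤k)) x≤k)

  D-head : ∃[ r ] D k j ≡ k ∷ r
  D-head with k ∸ j | m+[n∸m]≡n j≤k
  ... | zero  | eq = [] , cong (_∷ []) eq
  ... | suc d | eq = D′ j d , cong (_∷ D′ j d) eq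

record NextAbove (U : ℕ → Set) (e x v : ℕ) : Set where
  constructor nextAbove
  field
    rises  : x < v
    ≤end   : v ≤ e
    lands↑ : U v ⊎ v ≡ e
    skips↑ : ∀ y → x < y → y < v → ¬ U y

record NextBelow (U : ℕ → Set) (j x v : ℕ) : Set where
  constructor nextBelow
  field
    falls  : v < x
    start≤ : j ≤ v
    lands↓ : ¬ U v ⊎ v ≡ j
    skips↓ : ∀ y → v < y → y < x → U y

record ZigzagAt (U : ℕ → Set) (j e : ℕ) (f : ℕ → ℕ) (x : ℕ) : Set where
  constructor zigzagAt
  field
    up   : U x → NextAbove U e x (f x)
    down : ¬ U x → NextBelow U j x (f x)

open NextAbove public
open NextBelow public
open ZigzagAt public

Zigzag : (ℕ → Set) → ℕ → ℕ → (ℕ → ℕ) → Set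
Zigzag U j e f = ∀ x → j ≤ x → x ≤ e → ZigzagAt U j e f x

Ascent : (ℕ → ℕ) → ℕ → Set
Ascent f x = x < f x

module _ {U : ℕ → Set} where

  nextAbove-least : ∀ {e x v w} → NextAbove U e x v → NextAbove U e x w → v ≤ w
  nextAbove-least v↑ w↑ = ≮⇒≥ λ w<v → case (lands↑ w↑) w<v
    where
      case : _ → _ → ⊥
      case (inj₁ Uw)   w<v = skips↑ v↑ _ (rises w↑) w<v Uw
      case (inj₂ refl) w<v = <⇒≱ w<v (≤end v↑)

  nextBelow-greatest : ∀ {j x v w} → NextBelow U j x v → NextBelow U j x w → w ≤ v
  nextBelow-greatest v↓ w↓ = ≮⇒≥ λ v<w → case (lands↓ w↓) v<w
    where
      case : _ → _ → ⊥
      case (inj₁ ¬Uw)  v<w = ¬Uw (skips↓ v↓ _ v<w (falls w↓))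
      case (inj₂ refl) v<w = <⇒≱ v<w (start≤ v↓)

  zigzag-unique : Decidable U → ∀ {j e f g} → Zigzag U j e f → Zigzag U j e g →
                  ∀ x → j ≤ x → x ≤ e → f x ≡ g x
  zigzag-unique U? zf zg x j≤x x≤e with U? x | zf x j≤x x≤e | zg x j≤x x≤e
  ... | yes Ux | fx | gx =
    ≤-antisym (nextAbove-least (up fx Ux) (up gx Ux)) (nextAbove-least (up gx Ux) (up fx Ux))
  ... | no ¬Ux | fx | gx =
    ≤-antisym (nextBelow-greatest (down gx ¬Ux) (down fx ¬Ux)) (nextBelow-greatest (down fx ¬Ux) (down gx ¬Ux))

  zigzag-ext : ∀ {j e f g} → Zigzag U j e f → (∀ x → j ≤ x → x ≤ e → f x ≡ g x) → Zigzag U j e g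
  zigzag-ext {j} {e} zf f≗g x j≤x x≤e = zigzagAt
    (λ Ux → subst (NextAbove U e x) (f≗g x j≤x x≤e) (up (zf x j≤x x≤e) Ux))
    (λ ¬Ux → subst (NextBelow U j x) (f≗g x j≤x x≤e) (down (zf x j≤x x≤e) ¬Ux))

zigzag-cong : ∀ {U V : ℕ → Set} {j e f} →
              (∀ y → j ≤ y → y ≤ e → U y → V y) → (∀ y → j ≤ y → y ≤ e → V y → U y) →
              Zigzag U j e f → Zigzag V j e f
zigzag-cong {U} {V} {j} {e} {f} U⇒V V⇒U zf x j≤x x≤e =
  zigzagAt (λ Vx → above (up zx (V⇒U x j≤x x≤e Vx))) (λ ¬Vx → below (down zx (¬Vx ∘ U⇒V x j≤x x≤e)))
  where
    zx = zf x j≤x x≤e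
    above : NextAbove U e x (f x) → NextAbove V e x (f x)
    above (nextAbove x<v v≤e lands skips) = nextAbove x<v v≤e (lands′ lands)
      (λ y x<y y<v → skips y x<y y<v ∘ V⇒U y (≤-trans j≤x (<⇒≤ x<y)) (≤-trans (<⇒≤ y<v) v≤e))
      where
        lands′ : U (f x) ⊎ f x ≡ e → V (f x) ⊎ f x ≡ e
        lands′ (inj₁ Uv) = inj₁ (U⇒V (f x) (≤-trans j≤x (<⇒≤ x<v)) v≤e Uv)
        lands′ (inj₂ eq) = inj₂ eq
    below : NextBelow U j x (f x) → NextBelow V j x (f x)
    below (nextBelow v<x j≤v lands skips) = nextBelow v<x j≤v (lands′ lands)
      (λ y v<y y<x → U⇒V y (≤-trans j≤v (<⇒≤ v<y)) (≤-trans (<⇒≤ y<x) x≤e) (skips y v<y y<x))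
      where
        lands′ : ¬ U (f x) ⊎ f x ≡ j → ¬ V (f x) ⊎ f x ≡ j
        lands′ (inj₁ ¬Uv) = inj₁ (¬Uv ∘ V⇒U (f x) j≤v (≤-trans (<⇒≤ v<x) x≤e))
        lands′ (inj₂ eq)  = inj₂ eq

zigzag-ascents : ∀ {U : ℕ → Set} {j e f} → Decidable U → Zigzag U j e f → Zigzag (Ascent f) j e f
zigzag-ascents {U} {j} {e} {f} U? zf = zigzag-cong (λ y j≤y y≤e Uy → rises (up (zf y j≤y y≤e) Uy)) ascent⇒U zf
  where
    ascent⇒U : ∀ y → j ≤ y → y ≤ e → Ascent f y → U y
    ascent⇒U y j≤y y≤e y<fy with U? y
    ... | yes Uy = Uy
    ... | no ¬Uy = contradiction y<fy (<-asym (falls (down (zf y j≤y y≤e) ¬Uy)))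

NoneIn : (ℕ → Set) → ℕ → ℕ → Set
NoneIn P lo e = ∀ y → lo ≤ y → y < e → ¬ P y

module _ {P : ℕ → Set} (P? : Decidable P) where

  private
    noneIn-suc : ∀ {lo e} → NoneIn P lo e → ¬ (lo ≤ e × P e) → NoneIn P lo (suc e)
    noneIn-suc none ¬here y lo≤y y<1+e with m<1+n⇒m<n∨m≡n y<1+e
    ... | inj₁ y<e  = none y lo≤y y<e
    ... | inj₂ refl = λ Py → ¬here (lo≤y , Py)

  least-in : ∀ lo e → NoneIn P lo e ⊎ ∃[ y ] (lo ≤ y × y < e × P y × NoneIn P lo y)
  least-in lo zero = inj₁ (λ _ _ ())
  least-in lo (suc e) with least-in lo e
  ... | inj₂ (y , lo≤y , y<e , Py , min) = inj₂ (y , lo≤y , m<n⇒m<1+n y<e , Py , min)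
  ... | inj₁ none with (lo ≤? e) ×-dec P? e
  ...   | yes (lo≤e , Pe) = inj₂ (e , lo≤e , ≤-refl , Pe , none)
  ...   | no ¬here        = inj₁ (noneIn-suc none ¬here)

  greatest-in : ∀ lo e → NoneIn P lo e ⊎ ∃[ y ] (lo ≤ y × y < e × P y × (∀ z → y < z → z < e → ¬ P z))
  greatest-in lo zero = inj₁ (λ _ _ ())
  greatest-in lo (suc e) with (lo ≤? e) ×-dec P? e
  ... | yes (lo≤e , Pe) = inj₂ (e , lo≤e , ≤-refl , Pe , λ z e<z z<1+e → contradiction (≤-pred z<1+e) (<⇒≱ e<z))
  ... | no ¬here with greatest-in lo e
  ...   | inj₁ none = inj₁ (noneIn-suc none ¬here)
  ...   | inj₂ (y , lo≤y , y<e , Py , max) = inj₂ (y , lo≤y , m<n⇒m<1+n y<e , Py , max′)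
    where
      max′ : ∀ z → y < z → z < suc e → ¬ P z
      max′ z y<z z<1+e with m<1+n⇒m<n∨m≡n z<1+e
      ... | inj₁ z<e  = max z y<z z<e
      ... | inj₂ refl = λ Pz → ¬here (≤-trans lo≤y (<⇒≤ y<z) , Pz)

module _ {U : ℕ → Set} {j e : ℕ} {f : ℕ → ℕ} where

  zigzag-start : Decidable U → Zigzag U j e f → j ≤ e → U j
  zigzag-start U? zf j≤e with U? j
  ... | yes Uj = Uj
  ... | no ¬Uj = contradiction (start≤ v↓) (<⇒≱ (falls v↓))
    where v↓ = down (zf j ≤-refl j≤e) ¬Uj

  zigzag-end : Zigzag U j e f → j ≤ e → ¬ U e
  zigzag-end zf j≤e Ue = contradiction (≤end v↑) (<⇒≱ (rises v↑))
    where v↑ = up (zf e j≤e ≤-refl) Ue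

data Blocks (U : ℕ → Set) : ℕ → ℕ → List (ℕ × ℕ) → Set where
  final : ∀ {j k} → j ≤ k → (∀ y → j < y → y ≤ k → ¬ U y) →
          Blocks U j (suc k) ((k , j) ∷ [])
  block : ∀ {j k e bs} → j ≤ k → (∀ y → j < y → y ≤ k → ¬ U y) → U (suc k) →
          Blocks U (suc k) e bs → Blocks U j e ((k , j) ∷ bs)

module _ {U : ℕ → Set} {j k : ℕ} (j≤k : j ≤ k) (gap : ∀ y → j < y → y ≤ k → ¬ U y) where

  private
    lands-below : ∀ {y} → j ≤ y → y ≤ k → ¬ U y ⊎ y ≡ j
    lands-below j≤y y≤k with m≤n⇒m<n∨m≡n j≤y
    ... | inj₁ j<y  = inj₁ (gap _ j<y y≤k)
    ... | inj₂ refl = inj₂ refl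

    step-down : ∀ {y} → j ≤ y → y ≤ k → NextBelow U j (suc y) y
    step-down j≤y y≤k = nextBelow ≤-refl j≤y (lands-below j≤y y≤k)
      (λ z y<z z<1+y → contradiction (≤-pred z<1+y) (<⇒≱ y<z))

    start-rises : ∀ {e} → suc k ≤ e → U (suc k) ⊎ suc k ≡ e → NextAbove U e j (suc k)
    start-rises k<e lands = nextAbove (s≤s j≤k) k<e lands (λ y j<y y<1+k → gap y j<y (≤-pred y<1+k))

  D-zigzag : U j → ¬ U (suc k) → Zigzag U j (suc k) (evalWord (D k j))
  D-zigzag Uj ¬U1+k x j≤x x≤1+k with m≤n⇒m<n∨m≡n j≤x
  ... | inj₂ refl = zigzagAt
    (λ _ → subst (NextAbove U (suc k) j) (sym (evalWord-D-start j≤k)) (start-rises ≤-refl (inj₂ refl)))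
    (contradiction Uj)
  ... | inj₁ (s≤s {n = y} j≤y) = zigzagAt (⊥-elim ∘ ¬U1+y)
    (λ _ → subst (NextBelow U j (suc y)) (sym (evalWord-D-suc j≤k j≤y (≤-pred x≤1+k)))
                 (step-down j≤y (≤-pred x≤1+k)))
    where
      ¬U1+y : ¬ U (suc y)
      ¬U1+y with m≤n⇒m<n∨m≡n (≤-pred x≤1+k)
      ... | inj₁ y<k  = gap (suc y) (s≤s j≤y) y<k
      ... | inj₂ refl = ¬U1+k

  D-extends-zigzag : ∀ {e g} → U j → U (suc k) → suc k < e →
                     Zigzag U (suc k) e g → (∀ x → x < suc k → g x ≡ x) →
                     Zigzag U j e (evalWord (D k j) ∘ g)
  D-extends-zigzag {e} {g} Uj U1+k k<e zg g-fix x j≤x x≤e with m≤n⇒m<n∨m≡n j≤x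
  ... | inj₂ refl = zigzagAt
    (λ _ → subst (NextAbove U e j) (sym start-value) (start-rises (<⇒≤ k<e) (inj₁ U1+k)))
    (contradiction Uj)
    where
      start-value : evalWord (D k j) (g j) ≡ suc k
      start-value = trans (cong (evalWord (D k j)) (g-fix j (s≤s j≤k))) (evalWord-D-start j≤k)
  ... | inj₁ (s≤s {n = y} j≤y) with y <? k
  ...   | yes y<k = zigzagAt (⊥-elim ∘ gap (suc y) (s≤s j≤y) y<k)
    (λ _ → subst (NextBelow U j (suc y)) (sym inside-value) (step-down j≤y (<⇒≤ y<k)))
    where
      inside-value : evalWord (D k j) (g (suc y)) ≡ y
      inside-value = trans (cong (evalWord (D k j)) (g-fix (suc y) (s≤s y<k))) (evalWord-D-suc j≤k j≤y (<⇒≤ y<k))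
  ...   | no y≮k = zigzagAt beyond-up beyond-down
    where
      k<x : suc k ≤ suc y
      k<x = s≤s (≮⇒≥ y≮k)
      zx : ZigzagAt U (suc k) e g (suc y)
      zx = zg (suc y) k<x x≤e
      D-fixes : ∀ {v} → suc k < v → evalWord (D k j) v ≡ v
      D-fixes = evalWord-D-above j≤k
      beyond-up : U (suc y) → NextAbove U e (suc y) (evalWord (D k j) (g (suc y)))
      beyond-up Ux = subst (NextAbove U e (suc y)) (sym (D-fixes (≤-trans (s≤s k<x) (rises a)))) a
        where a = up zx Ux
      beyond-down : ¬ U (suc y) → NextBelow U j (suc y) (evalWord (D k j) (g (suc y)))
      beyond-down ¬Ux with down zx ¬Ux
      ... | nextBelow v<x k<v (inj₂ v≡1+k) skips = subst (NextBelow U j (suc y)) (sym k-value)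
        (nextBelow (≤-trans (n≤1+n _) (subst (_< suc y) v≡1+k v<x)) j≤k (lands-below j≤k ≤-refl) skips′)
        where
          k-value : evalWord (D k j) (g (suc y)) ≡ k
          k-value = trans (cong (evalWord (D k j)) v≡1+k) (evalWord-D-suc j≤k j≤k ≤-refl)
          skips′ : ∀ z → k < z → z < suc y → U z
          skips′ z k<z z<x with m≤n⇒m<n∨m≡n k<z
          ... | inj₂ refl = U1+k
          ... | inj₁ 1+k<z = skips z (subst (_< z) (sym v≡1+k) 1+k<z) z<x
      ... | nextBelow v<x k<v (inj₁ ¬Uv) skips with m≤n⇒m<n∨m≡n k<v
      ...   | inj₂ 1+k≡v = contradiction (subst U 1+k≡v U1+k) ¬Uv
      ...   | inj₁ 1+k<v = subst (NextBelow U j (suc y)) (sym (D-fixes 1+k<v))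
        (nextBelow v<x (≤-trans j≤k (≤-trans (n≤1+n k) k<v)) (inj₁ ¬Uv) skips)

module _ {U : ℕ → Set} where

  blocks-< : ∀ {j e bs} → Blocks U j e bs → j < e
  blocks-< (final j≤k _)       = s≤s j≤k
  blocks-< (block j≤k _ _ bs) = <-trans (s≤s j≤k) (blocks-< bs)

  evalWord-blocks-below : ∀ {j e bs} → Blocks U j e bs → ∀ x → x < j → evalWord (wordOf bs) x ≡ x
  evalWord-blocks-below {bs = (k , j) ∷ []} (final _ _) x x<j =
    trans (evalWord-++ (D k j) [] x) (evalWord-D-below x<j)
  evalWord-blocks-below {bs = (k , j) ∷ bs} (block j≤k _ _ rest) x x<j =
    trans (evalWord-++ (D k j) (wordOf bs) x)
      (trans (cong (evalWord (D k j)) (evalWord-blocks-below rest x (<-trans x<j (s≤s j≤k)))) (evalWord-D-below x<j))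

  blocks-zigzag : ∀ {j e bs} → Blocks U j e bs → U j → ¬ U e → Zigzag U j e (evalWord (wordOf bs))
  blocks-zigzag {bs = (k , j) ∷ []} (final j≤k gap) Uj ¬Ue =
    zigzag-ext (D-zigzag j≤k gap Uj ¬Ue) (λ x _ _ → sym (evalWord-++ (D k j) [] x))
  blocks-zigzag {bs = (k , j) ∷ bs} (block j≤k gap U1+k rest) Uj ¬Ue =
    zigzag-ext (D-extends-zigzag j≤k gap Uj U1+k (blocks-< rest) (blocks-zigzag rest U1+k ¬Ue) (evalWord-blocks-below rest))
               (λ x _ _ → sym (evalWord-++ (D k j) (wordOf bs) x))

  blocks-exist : Decidable U → ∀ {j e} → j < e → ∃ (Blocks U j e)
  blocks-exist U? {j} {e} j<e = go e j<e (m∸n≤m e j)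
    where
      one-block : ∀ {j} → j < e → NoneIn U (suc j) e → ∃ (Blocks U j e)
      one-block (s≤s j≤k) none = _ , final j≤k (λ y j<y y≤k → none y j<y (s≤s y≤k))
      go : ∀ d {j} → j < e → e ∸ j ≤ d → ∃ (Blocks U j e)
      go d {j} j<e e∸j≤d with least-in U? (suc j) e
      ... | inj₁ none = one-block j<e none
      go zero    j<e e∸j≤d | inj₂ _ = contradiction e∸j≤d (<⇒≱ (m<n⇒0<n∸m j<e))
      go (suc d) j<e e∸j≤d | inj₂ (suc k , s≤s j≤k , k<e , U1+k , min) =
        _ , block j≤k (λ y j<y y≤k → min y j<y (s≤s y≤k)) U1+k (proj₂ (go d k<e shorter))
        where
          shorter : e ∸ suc k ≤ d
          shorter = ≤-pred (≤-trans (∸-monoʳ-< (s≤s j≤k) (<⇒≤ k<e)) e∸j≤d)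

module _ {U : ℕ → Set} where

  blocks-valid : ∀ {j e bs} → 1 ≤ j → Blocks U j e bs → All (ValidFactor e) bs
  blocks-valid 1≤j (final j≤k _)        = (1≤j , j≤k , ≤-refl) ∷ []
  blocks-valid 1≤j (block j≤k _ _ rest) = (1≤j , j≤k , <⇒≤ (blocks-< rest)) ∷ blocks-valid (s≤s z≤n) rest

  blocks-linked : ∀ {j e bs} → Blocks U j e bs → Linked _<_ (map proj₁ bs)
  blocks-linked (final _ _)                          = [-]
  blocks-linked (block _ _ _ (final k<k′ _))         = k<k′ ∷ [-]
  blocks-linked (block _ _ _ rest@(block k<k′ _ _ _)) = k<k′ ∷ blocks-linked rest

  blocks-letters : ∀ {j e bs} → Blocks U j e bs → All (λ a → j ≤ a × a < e) (wordOf bs)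
  blocks-letters (final j≤k _) = ++⁺ (All.map (λ (j≤a , a≤k) → j≤a , s≤s a≤k) (D-letters j≤k)) []
  blocks-letters (block j≤k _ _ rest) =
    ++⁺ (All.map (λ (j≤a , a≤k) → j≤a , ≤-trans (s≤s a≤k) (<⇒≤ (blocks-< rest))) (D-letters j≤k))
        (All.map (λ (k<a , a<e) → ≤-trans j≤k (<⇒≤ k<a) , a<e) (blocks-letters rest))

  blocks-unique : ∀ {j e bs} → Blocks U j e bs → Unique (wordOf bs)
  blocks-unique {bs = (k , j) ∷ []} (final j≤k _) =
    AllPairs.++⁺ (D′-unique j (k ∸ j)) [] (All.map (λ _ → []) (D-letters j≤k))
  blocks-unique {bs = (k , j) ∷ bs} (block j≤k _ _ rest) =
    AllPairs.++⁺ (D′-unique j (k ∸ j)) (blocks-unique rest)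
      (All.map (λ (_ , a≤k) → All.map (λ (k<b , _) a≡b → <⇒≱ (s≤s a≤k) (subst (suc k ≤_) (sym a≡b) k<b))
                                       (blocks-letters rest))
               (D-letters j≤k))

blocks-starts : ∀ {U : ℕ → Set} {j e bs y} → Blocks U j e bs → y ∈ map proj₂ bs → j ≤ y × y < e
blocks-starts b@(final _ _)        (here refl) = ≤-refl , blocks-< b
blocks-starts b@(block _ _ _ _)    (here refl) = ≤-refl , blocks-< b
blocks-starts (block j≤k _ _ rest) (there y∈) with blocks-starts rest y∈
... | k<y , y<e = ≤-trans j≤k (<⇒≤ k<y) , y<e

blocks-start : ∀ {U : ℕ → Set} {j e bs} → Blocks U j e bs → j ∈ map proj₂ bs
blocks-start (final _ _)     = here refl
blocks-start (block _ _ _ _) = here refl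

blocks-cong : ∀ {U V : ℕ → Set} {j e bs} → (∀ y → j < y → U y → V y) → (∀ y → j < y → V y → U y) →
              Blocks U j e bs → Blocks V j e bs
blocks-cong U⇒V V⇒U (final j≤k gap) = final j≤k (λ y j<y y≤k → gap y j<y y≤k ∘ V⇒U y j<y)
blocks-cong U⇒V V⇒U (block j≤k gap U1+k rest) =
  block j≤k (λ y j<y y≤k → gap y j<y y≤k ∘ V⇒U y j<y) (U⇒V _ (s≤s j≤k) U1+k)
    (blocks-cong (λ y k<y → U⇒V y (<-trans (s≤s j≤k) k<y)) (λ y k<y → V⇒U y (<-trans (s≤s j≤k) k<y)) rest)

LacksLetter : ℕ → ℕ → List ℕ → Set
LacksLetter j n w = ∃[ i ] (j ≤ i × i < n × All (_≢ i) w)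

unique-++⁻ʳ : ∀ {A : Set} (xs : List A) {ys} → Unique (xs ++ ys) → Unique ys
unique-++⁻ʳ []       u       = u
unique-++⁻ʳ (_ ∷ xs) (_ ∷ u) = unique-++⁻ʳ xs u

-- k is the first letter of D(k, j) and also a letter of D(k′, j′).
overlapping-factors : ∀ {k j k′ j′ w} → j ≤ k → j′ ≤ k → k ≤ k′ → ¬ Unique (D k j ++ (D k′ j′ ++ w))
overlapping-factors {k} {j} {k′} {j′} {w} j≤k j′≤k k≤k′ u with D-head j≤k
... | r , D≡k∷r with subst (λ z → Unique (z ++ (D k′ j′ ++ w))) D≡k∷r u
...   | k∉rest ∷ _ = All.lookup k∉rest (∈-++⁺ʳ r (∈-++⁺ˡ (∈-D (≤-trans j′≤k k≤k′) j′≤k k≤k′))) refl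

unique-word-blocks : ∀ {n} k j rest → All (ValidFactor n) ((k , j) ∷ rest) → Linked _<_ (k ∷ map proj₁ rest) →
  Unique (wordOf ((k , j) ∷ rest)) →
  LacksLetter j n (wordOf ((k , j) ∷ rest)) ⊎ Blocks (_∈ map proj₂ ((k , j) ∷ rest)) j n ((k , j) ∷ rest)
unique-word-blocks {n} k j [] ((_ , j≤k , k<n) ∷ []) _ _ with m≤n⇒m<n∨m≡n k<n
... | inj₂ refl = inj₂ (final j≤k λ { y j<y _ (here refl) → <-irrefl refl j<y })
... | inj₁ 1+k<n = inj₁ (suc k , ≤-trans j≤k (n≤1+n k) , 1+k<n ,
                         ++⁺ (All.map (λ (_ , a≤k) → <⇒≢ (s≤s a≤k)) (D-letters j≤k)) [])
unique-word-blocks {n} k j ((k′ , j′) ∷ rest) ((_ , j≤k , _) ∷ valid) (k<k′ ∷ linked) u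
  with unique-word-blocks k′ j′ rest valid linked (unique-++⁻ʳ (D k j) u)
... | inj₁ (i , j′≤i , i<n , i∉) with k <? i
...   | yes k<i = inj₁ (i , ≤-trans j≤k (<⇒≤ k<i) , i<n ,
                        ++⁺ (All.map (λ (_ , a≤k) → <⇒≢ (≤-trans (s≤s a≤k) k<i)) (D-letters j≤k)) i∉)
...   | no k≮i = contradiction u (overlapping-factors j≤k (≤-trans j′≤i (≮⇒≥ k≮i)) (<⇒≤ k<k′))
unique-word-blocks {n} k j ((k′ , j′) ∷ rest) ((_ , j≤k , _) ∷ (_ , j′≤k′ , k′<n) ∷ _) (k<k′ ∷ _) u
    | inj₂ blocks with <-cmp j′ (suc k)
...   | tri< j′≤k _ _ = contradiction u (overlapping-factors j≤k (≤-pred j′≤k) (<⇒≤ k<k′))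
...   | tri≈ _ refl _ = inj₂ (block j≤k gap (there (here refl))
          (blocks-cong (λ _ _ → there) later-start blocks))
  where
    later-start : ∀ y → suc k < y → y ∈ map proj₂ ((k , j) ∷ (k′ , suc k) ∷ rest) → y ∈ map proj₂ ((k′ , suc k) ∷ rest)
    later-start y k<y (here refl) = contradiction (≤-trans j≤k (n≤1+n k)) (<⇒≱ k<y)
    later-start y _   (there y∈)  = y∈
    gap : ∀ y → j < y → y ≤ k → ¬ (y ∈ map proj₂ ((k , j) ∷ (k′ , suc k) ∷ rest))
    gap y j<y _   (here refl) = <-irrefl refl j<y
    gap y _   y≤k (there y∈)  = <⇒≱ (s≤s y≤k) (proj₁ (blocks-starts blocks y∈))
...   | tri> _ _ 1+k<j′ = inj₁ (suc k , ≤-trans j≤k (n≤1+n k) ,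
                                ≤-trans 1+k<j′ (≤-trans j′≤k′ (≤-trans (n≤1+n k′) k′<n)) ,
          ++⁺ (All.map (λ (_ , a≤k) → <⇒≢ (s≤s a≤k)) (D-letters j≤k))
              (All.map (λ (j′≤a , _) a≡1+k → <⇒≢ (≤-trans 1+k<j′ j′≤a) (sym a≡1+k)) (blocks-letters blocks)))

admissible-unique-blocks : ∀ {n} fs → 2 ≤ n → Admissible n fs → Unique (wordOf fs) →
  LacksLetter 1 n (wordOf fs) ⊎ Blocks (_∈ map proj₂ fs) 1 n fs
admissible-unique-blocks [] 2≤n _ _ = inj₁ (1 , ≤-refl , 2≤n , [])
admissible-unique-blocks ((k , j) ∷ rest) 2≤n (valid@((1≤j , _ , _) ∷ _) , linked) u
  with unique-word-blocks k j rest valid linked u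
... | inj₁ (i , j≤i , i<n , i∉) = inj₁ (i , ≤-trans 1≤j j≤i , i<n , i∉)
... | inj₂ blocks with m≤n⇒m<n∨m≡n 1≤j
...   | inj₂ refl = inj₂ blocks
...   | inj₁ 1<j  = inj₁ (1 , ≤-refl , 2≤n ,
                          All.map (λ (j≤a , _) a≡1 → <⇒≢ (≤-trans 1<j j≤a) (sym a≡1)) (blocks-letters blocks))

module _ {i a : ℕ} (a≢i : a ≢ i) where

  τ-keeps-≤ : ∀ {z} → z ≤ i → τ a z ≤ i
  τ-keeps-≤ {z} z≤i with z ≟ a | z ≟ suc a
  ... | yes refl | _        = subst (_≤ i) (sym (τ-left z)) (≤∧≢⇒< z≤i a≢i)
  ... | no _     | yes refl = subst (_≤ i) (sym (τ-right a)) (≤-trans (n≤1+n a) z≤i)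
  ... | no z≢a   | no z≢1+a = subst (_≤ i) (sym (τ-fix z≢a z≢1+a)) z≤i

  τ-keeps-> : ∀ {z} → i < z → i < τ a z
  τ-keeps-> {z} i<z with z ≟ a | z ≟ suc a
  ... | yes refl | _        = subst (i <_) (sym (τ-left z)) (m<n⇒m<1+n i<z)
  ... | no _     | yes refl = subst (i <_) (sym (τ-right a)) (≤∧≢⇒< (≤-pred i<z) (a≢i ∘ sym))
  ... | no z≢a   | no z≢1+a = subst (i <_) (sym (τ-fix z≢a z≢1+a)) i<z

module _ {i : ℕ} where

  evalWord-lacking-≤ : ∀ w {x} → All (_≢ i) w → x ≤ i → evalWord w x ≤ i
  evalWord-lacking-≤ []      _          x≤i = x≤i
  evalWord-lacking-≤ (a ∷ w) (a≢i ∷ w∌) x≤i = τ-keeps-≤ a≢i (evalWord-lacking-≤ w w∌ x≤i)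

  evalWord-lacking-> : ∀ w {x} → All (_≢ i) w → i < x → i < evalWord w x
  evalWord-lacking-> []      _          i<x = i<x
  evalWord-lacking-> (a ∷ w) (a≢i ∷ w∌) i<x = τ-keeps-> a≢i (evalWord-lacking-> w w∌ i<x)

module _ (c : ℕ → ℕ) where

  descending-≤ : ∀ {M} → (∀ t → suc t ≤ M → c (suc t) < c t) → ∀ {a b} → a ≤ b → b ≤ M → c b ≤ c a
  descending-≤ desc {b = zero}  z≤n _ = ≤-refl
  descending-≤ desc {b = suc b} a≤b b<M with m≤n⇒m<n∨m≡n a≤b
  ... | inj₂ refl = ≤-refl
  ... | inj₁ a<b  = ≤-trans (<⇒≤ (desc b b<M)) (descending-≤ desc (≤-pred a<b) (<⇒≤ b<M))

  ascending-≤ : ∀ {M T} → (∀ t → M ≤ t → t < T → c t < c (suc t)) →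
                ∀ {a b} → M ≤ a → a ≤ b → b ≤ T → c a ≤ c b
  ascending-≤ asc {b = zero}  _   z≤n _ = ≤-refl
  ascending-≤ asc {b = suc b} M≤a a≤b b<T with m≤n⇒m<n∨m≡n a≤b
  ... | inj₂ refl = ≤-refl
  ... | inj₁ a<b  =
    ≤-trans (ascending-≤ asc M≤a (≤-pred a<b) (<⇒≤ b<T)) (<⇒≤ (asc b (≤-trans M≤a (≤-pred a<b)) b<T))

1<1+j∸i⇒i<j : ∀ i j → 1 < suc j ∸ i → i < j
1<1+j∸i⇒i<j zero    j       1<1+j = ≤-pred 1<1+j
1<1+j∸i⇒i<j (suc i) zero    1<0∸i = contradiction (subst (1 <_) (0∸n≡0 i) 1<0∸i) λ ()
1<1+j∸i⇒i<j (suc i) (suc j) 1<1+j∸i = s≤s (1<1+j∸i⇒i<j i j 1<1+j∸i)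

module OnNumbers {m : ℕ} (π : Permutation′ (suc m)) where

  n : ℕ
  n = suc m

  -- π as a map of the numbers 1, …, n; the values outside [1, n] are irrelevant.
  π̂ : ℕ → ℕ
  π̂ zero = zero
  π̂ (suc y) with y <? n
  ... | yes y<n = suc (toℕ (π ⟨$⟩ʳ fromℕ< y<n))
  ... | no _    = suc y

  π̂-toℕ : ∀ X → π̂ (suc (toℕ X)) ≡ suc (toℕ (π ⟨$⟩ʳ X))
  π̂-toℕ X with toℕ X <? n
  ... | yes X<n = cong (λ Z → suc (toℕ (π ⟨$⟩ʳ Z))) (fromℕ<-toℕ X X<n)
  ... | no X≮n  = contradiction (toℕ<n X) X≮n

  toFin : ∀ x → 1 ≤ x → x ≤ n → Σ (Fin n) λ X → suc (toℕ X) ≡ x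
  toFin (suc y) _ y<n = fromℕ< y<n , cong suc (toℕ-fromℕ< y<n)

  π̂-range : ∀ x → 1 ≤ x → x ≤ n → 1 ≤ π̂ x × π̂ x ≤ n
  π̂-range x 1≤x x≤n with toFin x 1≤x x≤n
  ... | X , refl = subst (λ z → 1 ≤ z × z ≤ n) (sym (π̂-toℕ X)) (s≤s z≤n , toℕ<n (π ⟨$⟩ʳ X))

  π̂-surjective : ∀ y → 1 ≤ y → y ≤ n → ∃[ x ] (1 ≤ x × x ≤ n × π̂ x ≡ y)
  π̂-surjective y 1≤y y≤n with toFin y 1≤y y≤n
  ... | Y , refl = suc (toℕ (π ⟨$⟩ˡ Y)) , s≤s z≤n , toℕ<n _ ,
                   trans (π̂-toℕ _) (cong (suc ∘ toℕ) (inverseʳ π))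

  represents⇒π̂ : ∀ w → Represents w π → ∀ x → 1 ≤ x → x ≤ n → evalWord w x ≡ π̂ x
  represents⇒π̂ w rep x 1≤x x≤n with toFin x 1≤x x≤n
  ... | X , refl = trans (rep X) (sym (π̂-toℕ X))

  π̂⇒represents : ∀ {w} → (∀ x → 1 ≤ x → x ≤ n → evalWord w x ≡ π̂ x) → Represents w π
  π̂⇒represents w≗π̂ X = trans (w≗π̂ (suc (toℕ X)) (s≤s z≤n) (toℕ<n X)) (π̂-toℕ X)

  c : ℕ → ℕ
  c = cyc π

  c-zero : c 0 ≡ n
  c-zero = cong suc (toℕ-fromℕ m)

  c-suc : ∀ t → c (suc t) ≡ π̂ (c t)
  c-suc t = sym (π̂-toℕ (iter π t (fromℕ m)))

  1≤c : ∀ t → 1 ≤ c t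
  1≤c t = s≤s z≤n

  c≤n : ∀ t → c t ≤ n
  c≤n t = toℕ<n (iter π t (fromℕ m))

  c-covers : IsNCycle π → ∀ y → 1 ≤ y → y ≤ n → ∃[ t ] (t < n × c t ≡ y)
  c-covers ncycle y 1≤y y≤n with toFin y 1≤y y≤n
  ... | Y , refl with any? (λ T → iter π (toℕ T) (fromℕ m) Fin.≟ Y)
  ...   | yes (T , eq) = toℕ T , toℕ<n T , cong (suc ∘ toℕ) eq
  ...   | no Y∉orbit   = contradiction (injective⇒≤ {f = skipY} skipY-injective) (<-irrefl refl)
    where
      -- An orbit of size n missing Y would inject [n] into [n] ∖ {Y}.
      Y≢ : ∀ T → Y ≢ iter π (toℕ T) (fromℕ m)
      Y≢ T eq = Y∉orbit (T , sym eq)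
      skipY : Fin n → Fin m
      skipY T = Fin.punchOut (Y≢ T)
      skipY-injective : ∀ {S T} → skipY S ≡ skipY T → S ≡ T
      skipY-injective {S} {T} eq = toℕ-injective (ncycle (toℕ S) (toℕ T) (toℕ<n S) (toℕ<n T)
        (cong (suc ∘ toℕ) (punchOut-injective (Y≢ S) (Y≢ T) eq)))

  MapsOnto : ℕ → ℕ → ℕ → ℕ → Set
  MapsOnto i j a b = (∀ x → i ≤ x → x ≤ j → a ≤ π̂ x × π̂ x ≤ b) ×
                     (∀ y → 1 ≤ y → y ≤ n → a ≤ y → y ≤ b → ∃[ x ] (i ≤ x × x ≤ j × π̂ x ≡ y))

  imageIsSegment⇒mapsOnto : ∀ {i j} → 1 ≤ i → j ≤ n → ImageIsSegment π i j → ∃[ a ] ∃[ b ] MapsOnto i j a b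
  imageIsSegment⇒mapsOnto {i} {j} 1≤i j≤n (a , b , image) = a , b , into , onto
    where
      into : ∀ x → i ≤ x → x ≤ j → a ≤ π̂ x × π̂ x ≤ b
      into x i≤x x≤j with toFin x (≤-trans 1≤i i≤x) (≤-trans x≤j j≤n)
      ... | X , refl = subst (λ z → a ≤ z × z ≤ b) (sym (π̂-toℕ X))
                             (Equivalence.to (image (π ⟨$⟩ʳ X)) (X , (i≤x , x≤j) , refl))
      onto : ∀ y → 1 ≤ y → y ≤ n → a ≤ y → y ≤ b → ∃[ x ] (i ≤ x × x ≤ j × π̂ x ≡ y)
      onto y 1≤y y≤n a≤y y≤b with toFin y 1≤y y≤n
      ... | Y , refl with Equivalence.from (image Y) (a≤y , y≤b)
      ...   | X , (i≤x , x≤j) , refl = suc (toℕ X) , i≤x , x≤j , π̂-toℕ X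

  mapsOnto⇒imageIsSegment : ∀ {i j a b} → 1 ≤ i → j ≤ n → MapsOnto i j a b → ImageIsSegment π i j
  mapsOnto⇒imageIsSegment {i} {j} {a} {b} 1≤i j≤n (into , onto) = a , b , λ Y → mk⇔ (to Y) (from Y)
    where
      to : ∀ Y → ∃[ X ] (InSeg i j X × π ⟨$⟩ʳ X ≡ Y) → a ≤ suc (toℕ Y) × suc (toℕ Y) ≤ b
      to Y (X , (i≤x , x≤j) , refl) = subst (λ z → a ≤ z × z ≤ b) (π̂-toℕ X) (into _ i≤x x≤j)
      from : ∀ Y → a ≤ suc (toℕ Y) × suc (toℕ Y) ≤ b → ∃[ X ] (InSeg i j X × π ⟨$⟩ʳ X ≡ Y)
      from Y (a≤y , y≤b) with onto (suc (toℕ Y)) (s≤s z≤n) (toℕ<n Y) a≤y y≤b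
      ... | x , i≤x , x≤j , π̂x≡y with toFin x (≤-trans 1≤i i≤x) (≤-trans x≤j j≤n)
      ...   | X , refl = X , (i≤x , x≤j) , toℕ-injective (suc-injective (trans (sym (π̂-toℕ X)) π̂x≡y))

  ProperSegment : Set
  ProperSegment = ∃[ i ] ∃[ j ] (1 ≤ i × i ≤ j × j ≤ n × 1 < suc j ∸ i × suc j ∸ i < n × ImageIsSegment π i j)

  module _ (2≤m : 2 ≤ m) {w : List ℕ} (rep : Represents w π) where

    -- A missing letter i splits [1, n] into the two invariant segments [1, i] and [i + 1, n].
    lacking-letter⇒proper : LacksLetter 1 n w → ProperSegment
    lacking-letter⇒proper (1 , _ , _ , w∌1) =
      2 , n , s≤s z≤n , ≤-trans 2≤m (n≤1+n _) , ≤-refl , 2≤m , ≤-refl ,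
      mapsOnto⇒imageIsSegment (s≤s z≤n) ≤-refl (into , onto)
      where
        into : ∀ x → 2 ≤ x → x ≤ n → 2 ≤ π̂ x × π̂ x ≤ n
        into x 2≤x x≤n = subst (1 <_) (represents⇒π̂ w rep x (<⇒≤ 2≤x) x≤n) (evalWord-lacking-> w w∌1 2≤x) ,
                         proj₂ (π̂-range x (<⇒≤ 2≤x) x≤n)
        onto : ∀ y → 1 ≤ y → y ≤ n → 2 ≤ y → y ≤ n → ∃[ x ] (2 ≤ x × x ≤ n × π̂ x ≡ y)
        onto y 1≤y y≤n 2≤y _ with π̂-surjective y 1≤y y≤n
        ... | x , 1≤x , x≤n , π̂x≡y with 2 ≤? x
        ...   | yes 2≤x = x , 2≤x , x≤n , π̂x≡y
        ...   | no 2≰x  = contradiction (subst (_≤ 1) (trans (represents⇒π̂ w rep x 1≤x x≤n) π̂x≡y)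
                                                 (evalWord-lacking-≤ w w∌1 (≤-pred (≰⇒> 2≰x))))
                                         (<⇒≱ 2≤y)
    lacking-letter⇒proper (i@(suc (suc _)) , _ , i<n , w∌i) =
      1 , i , ≤-refl , s≤s z≤n , <⇒≤ i<n , s≤s (s≤s z≤n) , i<n ,
      mapsOnto⇒imageIsSegment ≤-refl (<⇒≤ i<n) (into , onto)
      where
        into : ∀ x → 1 ≤ x → x ≤ i → 1 ≤ π̂ x × π̂ x ≤ i
        into x 1≤x x≤i = proj₁ (π̂-range x 1≤x (≤-trans x≤i (<⇒≤ i<n))) ,
                         subst (_≤ i) (represents⇒π̂ w rep x 1≤x (≤-trans x≤i (<⇒≤ i<n))) (evalWord-lacking-≤ w w∌i x≤i)
        onto : ∀ y → 1 ≤ y → y ≤ n → 1 ≤ y → y ≤ i → ∃[ x ] (1 ≤ x × x ≤ i × π̂ x ≡ y)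
        onto y 1≤y y≤n _ y≤i with π̂-surjective y 1≤y y≤n
        ... | x , 1≤x , x≤n , π̂x≡y with x ≤? i
        ...   | yes x≤i = x , 1≤x , x≤i , π̂x≡y
        ...   | no x≰i  = contradiction y≤i (<⇒≱ (subst (i <_) (trans (represents⇒π̂ w rep x 1≤x x≤n) π̂x≡y)
                                                               (evalWord-lacking-> w w∌i (≰⇒> x≰i))))

  ConsecutiveRun : ℕ → Set
  ConsecutiveRun x = 1 ≤ x × suc (suc x) ≤ n ×
    ((π̂ x ≡ suc x × π̂ (suc x) ≡ suc (suc x)) ⊎ (π̂ (suc (suc x)) ≡ suc x × π̂ (suc x) ≡ x))

  adjacent-pair-proper : 2 ≤ m → ∀ {s t} → 1 ≤ s → suc s ≤ n → π̂ s ≡ t → π̂ (suc s) ≡ suc t → ProperSegment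
  adjacent-pair-proper 2≤m {s} {t} 1≤s s<n π̂s≡t π̂1+s≡1+t =
    s , suc s , 1≤s , n≤1+n s , s<n , size≡2 {1 <_} (s≤s (s≤s z≤n)) , size≡2 {_< n} (s≤s 2≤m) ,
    mapsOnto⇒imageIsSegment 1≤s s<n (into , onto)
    where
      size≡2 : ∀ {P : ℕ → Set} → P 2 → P (suc (suc s) ∸ s)
      size≡2 {P} = subst P (sym (m+n∸n≡m 2 s))
      into : ∀ x → s ≤ x → x ≤ suc s → t ≤ π̂ x × π̂ x ≤ suc t
      into x s≤x x≤1+s with m≤n⇒m<n∨m≡n x≤1+s
      ... | inj₂ refl = subst (λ v → t ≤ v × v ≤ suc t) (sym π̂1+s≡1+t) (n≤1+n t , ≤-refl)
      ... | inj₁ x<1+s with ≤-antisym s≤x (≤-pred x<1+s)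
      ...   | refl = subst (λ v → t ≤ v × v ≤ suc t) (sym π̂s≡t) (≤-refl , n≤1+n t)
      onto : ∀ y → 1 ≤ y → y ≤ n → t ≤ y → y ≤ suc t → ∃[ x ] (s ≤ x × x ≤ suc s × π̂ x ≡ y)
      onto y _ _ t≤y y≤1+t with m≤n⇒m<n∨m≡n y≤1+t
      ... | inj₂ refl = suc s , n≤1+n s , ≤-refl , π̂1+s≡1+t
      ... | inj₁ y<1+t with ≤-antisym t≤y (≤-pred y<1+t)
      ...   | refl = s , ≤-refl , n≤1+n s , π̂s≡t

  run⇒proper : 2 ≤ m → ∀ {x} → ConsecutiveRun x → ProperSegment
  run⇒proper 2≤m (1≤x , x+2≤n , inj₁ (π̂x , π̂x+1)) = adjacent-pair-proper 2≤m 1≤x (<⇒≤ x+2≤n) π̂x π̂x+1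
  run⇒proper 2≤m (1≤x , x+2≤n , inj₂ (π̂x+2 , π̂x+1)) = adjacent-pair-proper 2≤m (s≤s z≤n) x+2≤n π̂x+1 π̂x+2

  contains-three⇒run : ContainsThreeConsecutive π → ∃ ConsecutiveRun
  contains-three⇒run (t , _ , inj₁ (c₁ , c₂)) =
    c t , 1≤c t , subst (_≤ n) (trans c₂ (cong suc c₁)) (c≤n (suc (suc t))) ,
    inj₁ (trans (sym (c-suc t)) c₁ , trans (cong π̂ (sym c₁)) (trans (sym (c-suc (suc t))) (trans c₂ (cong suc c₁))))
  contains-three⇒run (t , _ , inj₂ (c₀ , c₁)) =
    c (suc (suc t)) , 1≤c (suc (suc t)) , subst (_≤ n) (trans c₀ (cong suc c₁)) (c≤n t) ,
    inj₂ (trans (cong π̂ (sym (trans c₀ (cong suc c₁)))) (trans (sym (c-suc t)) c₁) ,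
          trans (cong π̂ (sym c₁)) (sym (c-suc (suc t))))

  run⇒contains-three : IsNCycle π → ∀ {x} → ConsecutiveRun x → ContainsThreeConsecutive π
  run⇒contains-three ncycle {x} (1≤x , x+2≤n , inj₁ (π̂x , π̂x+1))
    with c-covers ncycle x 1≤x (≤-trans (n≤1+n _) (≤-trans (n≤1+n _) x+2≤n))
  ... | t , t<n , refl = t , t<n , inj₁ (c₁ , c₂)
    where
      c₁ : c (suc t) ≡ suc (c t)
      c₁ = trans (c-suc t) π̂x
      c₂ : c (suc (suc t)) ≡ suc (c (suc t))
      c₂ = trans (c-suc (suc t)) (trans (cong π̂ c₁) (trans π̂x+1 (cong suc (sym c₁))))
  run⇒contains-three ncycle {x} (1≤x , x+2≤n , inj₂ (π̂x+2 , π̂x+1))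
    with c-covers ncycle (suc (suc x)) (s≤s z≤n) x+2≤n
  ... | t , t<n , c≡x+2 = t , t<n , inj₂ (trans c≡x+2 (cong suc (sym c₁)) , trans c₁ (cong suc (sym c₂)))
    where
      c₁ : c (suc t) ≡ suc x
      c₁ = trans (c-suc t) (trans (cong π̂ c≡x+2) π̂x+2)
      c₂ : c (suc (suc t)) ≡ x
      c₂ = trans (c-suc (suc t)) (trans (cong π̂ c₁) π̂x+1)

  π̂-injective : ∀ x y → 1 ≤ x → x ≤ n → 1 ≤ y → y ≤ n → π̂ x ≡ π̂ y → x ≡ y
  π̂-injective x y 1≤x x≤n 1≤y y≤n π̂x≡π̂y with toFin x 1≤x x≤n | toFin y 1≤y y≤n
  ... | X , refl | Y , refl = cong (suc ∘ toℕ) (begin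
    X                       ≡⟨ inverseˡ π ⟨
    π ⟨$⟩ˡ (π ⟨$⟩ʳ X)       ≡⟨ cong (π ⟨$⟩ˡ_) πX≡πY ⟩
    π ⟨$⟩ˡ (π ⟨$⟩ʳ Y)       ≡⟨ inverseˡ π ⟩
    Y                       ∎)
    where
      open ≡-Reasoning
      πX≡πY : π ⟨$⟩ʳ X ≡ π ⟨$⟩ʳ Y
      πX≡πY = toℕ-injective (suc-injective (trans (sym (π̂-toℕ X)) (trans π̂x≡π̂y (π̂-toℕ Y))))

  ascent? : Decidable (Ascent π̂)
  ascent? y = y <? π̂ y

  IsZigzag : Set
  IsZigzag = Zigzag (Ascent π̂) 1 n π̂

  zigzag⇒bS : 1 ≤ m → IsZigzag → InbS π
  zigzag⇒bS 1≤m zigzag with blocks-exist ascent? (s≤s 1≤m)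
  ... | bs , blocks = bs , (blocks-valid ≤-refl blocks , blocks-linked blocks) ,
    π̂⇒represents {wordOf bs} (zigzag-unique ascent? word-zigzag zigzag) , blocks-unique blocks
    where
      word-zigzag : Zigzag (Ascent π̂) 1 n (evalWord (wordOf bs))
      word-zigzag = blocks-zigzag blocks (zigzag-start ascent? zigzag (s≤s z≤n)) (zigzag-end zigzag (s≤s z≤n))

  bS∧sS⇒zigzag : 2 ≤ m → InbS π → InsS π → IsZigzag
  bS∧sS⇒zigzag 2≤m (fs , admissible , rep , unique) segment-simple
    with admissible-unique-blocks fs (≤-trans 2≤m (n≤1+n m)) admissible unique
  ... | inj₁ lacks  = contradiction (lacking-letter⇒proper 2≤m rep lacks) segment-simple
  ... | inj₂ blocks = zigzag-ascents (_∈? map proj₂ fs) (zigzag-ext word-zigzag (represents⇒π̂ (wordOf fs) rep))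
    where
      n∉starts : ¬ (n ∈ map proj₂ fs)
      n∉starts n∈ = <-irrefl refl (proj₂ (blocks-starts blocks n∈))
      word-zigzag : Zigzag (_∈ map proj₂ fs) 1 n (evalWord (wordOf fs))
      word-zigzag = blocks-zigzag blocks (blocks-start blocks) n∉starts

  module FromUnimodalCycle (1≤m : 1 ≤ m) (ncycle : IsNCycle π) (unimodal : Unimodal π) where

    M : ℕ
    M = proj₁ unimodal

    desc : ∀ t → suc t ≤ M → c (suc t) < c t
    desc = proj₁ (proj₂ (proj₂ unimodal))

    asc : ∀ t → M ≤ t → t < m → c t < c (suc t)
    asc t M≤t t<m = proj₂ (proj₂ (proj₂ unimodal)) t M≤t (s≤s t<m)

    c-returns : c n ≡ n
    c-returns with c-covers ncycle (c n) (1≤c n) (c≤n n)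
    ... | zero  , _   , c₀≡cₙ = trans (sym c₀≡cₙ) c-zero
    ... | suc t , t<n , cₜ₊₁≡cₙ =
      contradiction (ncycle t m (<-trans (n<1+n t) t<n) ≤-refl cₜ≡cₘ) (<⇒≢ (≤-pred t<n))
      where
        cₜ≡cₘ : c t ≡ c m
        cₜ≡cₘ = π̂-injective (c t) (c m) (1≤c t) (c≤n t) (1≤c m) (c≤n m)
                  (trans (sym (c-suc t)) (trans cₜ₊₁≡cₙ (c-suc m)))

    c-M≡1 : c M ≡ 1
    c-M≡1 with c-covers ncycle 1 ≤-refl (s≤s z≤n)
    ... | t , t<n , cₜ≡1 with t ≤? M
    ...   | yes t≤M = ≤-antisym (subst (c M ≤_) cₜ≡1 (descending-≤ c desc t≤M ≤-refl)) (1≤c M)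
    ...   | no t≰M  =
      ≤-antisym (subst (c M ≤_) cₜ≡1 (ascending-≤ c asc ≤-refl (<⇒≤ (≰⇒> t≰M)) (≤-pred t<n))) (1≤c M)

    ascent-at : ∀ t → M ≤ t → t ≤ m → Ascent π̂ (c t)
    ascent-at t M≤t t≤m = subst (c t <_) (c-suc t) (c-rises t≤m)
      where
        c-rises : t ≤ m → c t < c (suc t)
        c-rises t≤m with m≤n⇒m<n∨m≡n t≤m
        ... | inj₁ t<m  = asc t M≤t t<m
        ... | inj₂ refl = subst (c m <_) (sym c-returns) (≤∧≢⇒< (c≤n m) (λ cₘ≡n →
                            <⇒≢ 1≤m (sym (ncycle m 0 ≤-refl (s≤s z≤n) (trans cₘ≡n (sym c-zero))))))

    descent-at : ∀ t → t < M → π̂ (c t) < c t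
    descent-at t t<M = subst (_< c t) (c-suc t) (desc t t<M)

    zigzag-while-descending : ∀ t → t < M → ZigzagAt (Ascent π̂) 1 n π̂ (c t)
    zigzag-while-descending t t<M = zigzagAt (λ ascent → contradiction ascent (<-asym (descent-at t t<M)))
      (λ _ → subst (NextBelow (Ascent π̂) 1 (c t)) (c-suc t) (nextBelow (desc t t<M) (1≤c (suc t)) lands skips))
      where
        lands : ¬ Ascent π̂ (c (suc t)) ⊎ c (suc t) ≡ 1
        lands with m≤n⇒m<n∨m≡n t<M
        ... | inj₁ t+1<M = inj₁ (<-asym (descent-at (suc t) t+1<M))
        ... | inj₂ refl  = inj₂ c-M≡1
        skips : ∀ y → c (suc t) < y → y < c t → Ascent π̂ y
        skips y cₜ₊₁<y y<cₜ with c-covers ncycle y (≤-trans (s≤s z≤n) cₜ₊₁<y) (≤-trans (<⇒≤ y<cₜ) (c≤n t))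
        ... | t′ , t′<n , refl with t′ <? M
        ...   | no t′≮M = ascent-at t′ (≮⇒≥ t′≮M) (≤-pred t′<n)
        ...   | yes t′<M with t′ ≤? t
        ...     | yes t′≤t = contradiction (descending-≤ c desc t′≤t (<⇒≤ t<M)) (<⇒≱ y<cₜ)
        ...     | no t′≰t  = contradiction (descending-≤ c desc (≰⇒> t′≰t) (<⇒≤ t′<M)) (<⇒≱ cₜ₊₁<y)

    zigzag-while-ascending : ∀ t → M ≤ t → t ≤ m → ZigzagAt (Ascent π̂) 1 n π̂ (c t)
    zigzag-while-ascending t M≤t t≤m = zigzagAt
      (λ _ → subst (NextAbove (Ascent π̂) n (c t)) (c-suc t) (nextAbove cₜ<cₜ₊₁ (c≤n (suc t)) lands skips))
      (λ ¬ascent → contradiction (ascent-at t M≤t t≤m) ¬ascent)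
      where
        cₜ<cₜ₊₁ : c t < c (suc t)
        cₜ<cₜ₊₁ = subst (c t <_) (sym (c-suc t)) (ascent-at t M≤t t≤m)
        lands : Ascent π̂ (c (suc t)) ⊎ c (suc t) ≡ n
        lands with m≤n⇒m<n∨m≡n t≤m
        ... | inj₁ t<m  = inj₁ (ascent-at (suc t) (≤-trans M≤t (n≤1+n t)) t<m)
        ... | inj₂ refl = inj₂ c-returns
        skips : ∀ y → c t < y → y < c (suc t) → ¬ Ascent π̂ y
        skips y cₜ<y y<cₜ₊₁ with c-covers ncycle y (≤-trans (s≤s z≤n) cₜ<y) (≤-trans (<⇒≤ y<cₜ₊₁) (c≤n (suc t)))
        ... | t′ , t′<n , refl with t′ <? M
        ...   | yes t′<M = <-asym (descent-at t′ t′<M)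
        ...   | no t′≮M with t′ ≤? t
        ...     | yes t′≤t = contradiction (ascending-≤ c asc (≮⇒≥ t′≮M) t′≤t t≤m) (<⇒≱ cₜ<y)
        ...     | no t′≰t  =
          contradiction (ascending-≤ c asc (≤-trans M≤t (n≤1+n t)) (≰⇒> t′≰t) (≤-pred t′<n)) (<⇒≱ y<cₜ₊₁)

    zigzag : IsZigzag
    zigzag x 1≤x x≤n with c-covers ncycle x 1≤x x≤n
    ... | t , t<n , refl with t <? M
    ...   | yes t<M = zigzag-while-descending t t<M
    ...   | no t≮M  = zigzag-while-ascending t (≮⇒≥ t≮M) (≤-pred t<n)

  module ToUnimodalCycle (zigzag : IsZigzag) where

    Up : ℕ → Set
    Up t = Ascent π̂ (c t)

    zigzag-at : ∀ t → ZigzagAt (Ascent π̂) 1 n π̂ (c t)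
    zigzag-at t = zigzag (c t) (1≤c t) (c≤n t)

    falls-at : ∀ t → ¬ Up t → c (suc t) < c t
    falls-at t ¬up = subst (_< c t) (sym (c-suc t)) (falls (down (zigzag-at t) ¬up))

    rises-at : ∀ t → Up t → c t < c (suc t)
    rises-at t up = subst (c t <_) (sym (c-suc t)) up

    1-ascent : Ascent π̂ 1
    1-ascent = zigzag-start ascent? zigzag (s≤s z≤n)

    ¬n-ascent : ¬ Ascent π̂ n
    ¬n-ascent = zigzag-end zigzag (s≤s z≤n)

    descents-bounded : ∀ T → (∀ t → t < T → ¬ Up t) → c T + T ≤ n
    descents-bounded zero    _     = ≤-reflexive (trans (+-identityʳ _) c-zero)
    descents-bounded (suc T) falls = begin
      c (suc T) + suc T   ≡⟨ +-suc _ T ⟩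
      suc (c (suc T) + T) ≤⟨ +-monoˡ-≤ T (falls-at T (falls T ≤-refl)) ⟩
      c T + T             ≤⟨ descents-bounded T (λ t t<T → falls t (m<n⇒m<1+n t<T)) ⟩
      n                   ∎
      where open ≤-Reasoning

    first-ascent : ∃[ M ] (Up M × NoneIn Up 0 M)
    first-ascent with least-in (ascent? ∘ c) 0 (suc n)
    ... | inj₂ (M , _ , _ , up , before) = M , up , before
    ... | inj₁ none = contradiction (descents-bounded n (λ t t<n → none t z≤n (m<n⇒m<1+n t<n)))
                                    (<⇒≱ (+-monoˡ-≤ n (1≤c n)))

    M : ℕ
    M = proj₁ first-ascent

    before-M : ∀ t → t < M → ¬ Up t
    before-M t = proj₂ (proj₂ first-ascent) t z≤n

    M<n : M < n
    M<n = <-≤-trans (+-monoˡ-≤ M (1≤c M)) (descents-bounded M before-M)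

    ascents-bounded : ∀ r → (∀ t → M ≤ t → t < M + r → Up t) → c M + r ≤ c (M + r)
    ascents-bounded zero    _     = ≤-reflexive (trans (+-identityʳ _) (cong c (sym (+-identityʳ M))))
    ascents-bounded (suc r) rises = begin
      c M + suc r     ≡⟨ +-suc _ r ⟩
      suc (c M + r)   ≤⟨ s≤s (ascents-bounded r λ t M≤t t<M+r → rises t M≤t (≤-trans t<M+r (+-monoʳ-≤ M (n≤1+n r)))) ⟩
      suc (c (M + r)) ≤⟨ rises-at (M + r) (rises (M + r) (m≤m+n M r) (+-monoʳ-< M ≤-refl)) ⟩
      c (suc (M + r)) ≡⟨ cong c (+-suc M r) ⟨
      c (M + suc r)   ∎
      where open ≤-Reasoning

    first-descent-after-M : ∃[ T ] (M < T × ¬ Up T × (∀ t → M ≤ t → t < T → Up t))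
    first-descent-after-M with least-in (¬? ∘ ascent? ∘ c) M (suc (M + n))
    ... | inj₂ (T , M≤T , _ , ¬up , before) =
      T , ≤∧≢⇒< M≤T (λ { refl → ¬up (proj₁ (proj₂ first-ascent)) }) , ¬up ,
      (λ t M≤t t<T → decidable-stable (ascent? (c t)) (before t M≤t t<T))
    ... | inj₁ none = contradiction
      (≤-trans (ascents-bounded n (λ t M≤t t<M+n → decidable-stable (ascent? (c t)) (none t M≤t (m<n⇒m<1+n t<M+n))))
               (c≤n (M + n)))
      (<⇒≱ (+-monoˡ-≤ n (1≤c M)))

    T : ℕ
    T = proj₁ first-descent-after-M

    M<T : M < T
    M<T = proj₁ (proj₂ first-descent-after-M)

    between-M-T : ∀ t → M ≤ t → t < T → Up t
    between-M-T = proj₂ (proj₂ (proj₂ first-descent-after-M))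

    -- The orbit leaves the descents only at 1 and the ascents only at n.
    c-M≡1 : c M ≡ 1
    c-M≡1 with M | proj₁ (proj₂ first-ascent) | before-M
    ... | zero  | up | _      = contradiction (subst (Ascent π̂) c-zero up) ¬n-ascent
    ... | suc t | up | before with lands↓ (down (zigzag-at t) (before t ≤-refl))
    ...   | inj₁ ¬up′ = contradiction (subst (Ascent π̂) (c-suc t) up) ¬up′
    ...   | inj₂ π̂cₜ≡1 = trans (c-suc t) π̂cₜ≡1

    c-T≡n : c T ≡ n
    c-T≡n with T | M<T | proj₁ (proj₂ (proj₂ first-descent-after-M)) | between-M-T
    ... | suc t | s≤s M≤t | ¬up | between with lands↑ (up (zigzag-at t) (between t M≤t ≤-refl))
    ...   | inj₁ up′  = contradiction (subst (Ascent π̂) (sym (c-suc t)) up′) ¬up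
    ...   | inj₂ π̂cₜ≡n = trans (c-suc t) π̂cₜ≡n

    descending : ∀ t → suc t ≤ M → c (suc t) < c t
    descending t t<M = falls-at t (before-M t t<M)

    ascending : ∀ t → M ≤ t → t < T → c t < c (suc t)
    ascending t M≤t t<T = rises-at t (between-M-T t M≤t t<T)

    c-injective-below-T : ∀ s t → s < t → t < T → c s ≢ c t
    c-injective-below-T s (suc t) (s≤s s≤t) t<T cₛ≡cₜ with suc t ≤? M
    ... | yes t<M = <-irrefl (sym cₛ≡cₜ) (<-≤-trans (descending t t<M) (descending-≤ c descending s≤t (<⇒≤ t<M)))
    ... | no t≮M with s <? M
    ...   | yes s<M = before-M s s<M (subst (Ascent π̂) (sym cₛ≡cₜ) (between-M-T (suc t) (<⇒≤ (≰⇒> t≮M)) t<T))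
    ...   | no s≮M  = <-irrefl cₛ≡cₜ (<-≤-trans (ascending s (≮⇒≥ s≮M) (≤-trans (s≤s s≤t) (<⇒≤ t<T)))
                                          (ascending-≤ c ascending (≤-trans (≮⇒≥ s≮M) (n≤1+n s)) (s≤s s≤t) (<⇒≤ t<T)))

    -- A value y missed by the orbit would lie strictly between two consecutive
    -- orbit points of its own kind, which the zigzag forbids.
    c-covers-below-T : ∀ y → 1 ≤ y → y ≤ n → ∃[ t ] (t < T × c t ≡ y)
    c-covers-below-T y 1≤y y≤n with ascent? y
    ... | no ¬y↑ with greatest-in (λ t → y ≤? c t) 0 M
    ...   | inj₁ none = contradiction (subst (y ≤_) (sym c-zero) y≤n) (none 0 z≤n 0<M)
      where
        0<M : 0 < M
        0<M = ≤∧≢⇒< z≤n (λ 0≡M → ¬n-ascent (subst (Ascent π̂) c-zero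
                                   (subst Up (sym 0≡M) (proj₁ (proj₂ first-ascent)))))
    ...   | inj₂ (t , _ , t<M , y≤cₜ , last) with y ≟ c t
    ...     | yes y≡cₜ = t , <-trans t<M M<T , sym y≡cₜ
    ...     | no y≢cₜ  =
      contradiction (skips↓ (down (zigzag-at t) (before-M t t<M)) y π̂cₜ<y (≤∧≢⇒< y≤cₜ y≢cₜ)) ¬y↑
      where
        π̂cₜ<y : π̂ (c t) < y
        π̂cₜ<y with suc t <? M
        ... | yes t+1<M = subst (_< y) (c-suc t) (≰⇒> (last (suc t) ≤-refl t+1<M))
        ... | no t+1≮M  = subst (_< y) (sym π̂cₜ≡1) (≤∧≢⇒< 1≤y (λ 1≡y → ¬y↑ (subst (Ascent π̂) 1≡y 1-ascent)))
          where
            π̂cₜ≡1 : π̂ (c t) ≡ 1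
            π̂cₜ≡1 = trans (sym (c-suc t)) (trans (cong c (≤-antisym t<M (≮⇒≥ t+1≮M))) c-M≡1)
    c-covers-below-T y 1≤y y≤n | yes y↑ with greatest-in (λ t → c t ≤? y) M T
    ...   | inj₁ none = contradiction (subst (_≤ y) (sym c-M≡1) 1≤y) (none M ≤-refl M<T)
    ...   | inj₂ (t , M≤t , t<T , cₜ≤y , last) with c t ≟ y
    ...     | yes cₜ≡y = t , t<T , cₜ≡y
    ...     | no cₜ≢y  =
      ⊥-elim (skips↑ (up (zigzag-at t) (between-M-T t M≤t t<T)) y (≤∧≢⇒< cₜ≤y cₜ≢y) y<π̂cₜ y↑)
      where
        y<π̂cₜ : y < π̂ (c t)
        y<π̂cₜ with suc t <? T
        ... | yes t+1<T = subst (y <_) (c-suc t) (≰⇒> (last (suc t) ≤-refl t+1<T))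
        ... | no t+1≮T  = subst (y <_) (sym π̂cₜ≡n) (≤∧≢⇒< y≤n (λ y≡n → ¬n-ascent (subst (Ascent π̂) y≡n y↑)))
          where
            π̂cₜ≡n : π̂ (c t) ≡ n
            π̂cₜ≡n = trans (sym (c-suc t)) (trans (cong c (≤-antisym t<T (≮⇒≥ t+1≮T))) c-T≡n)

    n≤T : n ≤ T
    n≤T = injective⇒≤ {f = position} position-injective
      where
        visit : (Y : Fin n) → ∃[ t ] (t < T × c t ≡ suc (toℕ Y))
        visit Y = c-covers-below-T (suc (toℕ Y)) (s≤s z≤n) (toℕ<n Y)
        position : Fin n → Fin T
        position Y = fromℕ< (proj₁ (proj₂ (visit Y)))
        position-injective : ∀ {Y Z} → position Y ≡ position Z → Y ≡ Z
        position-injective {Y} {Z} eq = toℕ-injective (suc-injective (begin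
          suc (toℕ Y)      ≡⟨ proj₂ (proj₂ (visit Y)) ⟨
          c (proj₁ (visit Y)) ≡⟨ cong c same-time ⟩
          c (proj₁ (visit Z)) ≡⟨ proj₂ (proj₂ (visit Z)) ⟩
          suc (toℕ Z)      ∎))
          where
            open ≡-Reasoning
            same-time : proj₁ (visit Y) ≡ proj₁ (visit Z)
            same-time = trans (sym (toℕ-fromℕ< _)) (trans (cong toℕ eq) (toℕ-fromℕ< _))

    ncycle : IsNCycle π
    ncycle s t s<n t<n cₛ≡cₜ with <-cmp s t
    ... | tri< s<t _ _ = contradiction cₛ≡cₜ (c-injective-below-T s t s<t (≤-trans t<n n≤T))
    ... | tri≈ _ s≡t _ = s≡t
    ... | tri> _ _ t<s = contradiction (sym cₛ≡cₜ) (c-injective-below-T t s t<s (≤-trans s<n n≤T))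

    unimodal : Unimodal π
    unimodal = M , M<n , descending ,
      λ t M≤t t+1<n → ascending t M≤t (≤-trans (≤-pred t+1<n) (≤-trans (n≤1+n m) n≤T))

  module SegmentSimple (zigzag : IsZigzag) (no-run : ∀ x → ¬ ConsecutiveRun x) where

    module _ {s₀ r a b : ℕ} (1≤s₀ : 1 ≤ s₀) (s₀≤1+r : s₀ ≤ suc r) (s₁≤n : suc (suc r) ≤ n)
             (maps : MapsOnto s₀ (suc (suc r)) a b) where

      private
        s₁ : ℕ
        s₁ = suc (suc r)

        s₀<s₁ : s₀ < s₁
        s₀<s₁ = s≤s s₀≤1+r

        zigzag-in : ∀ x → s₀ ≤ x → x ≤ s₁ → ZigzagAt (Ascent π̂) 1 n π̂ x
        zigzag-in x s₀≤x x≤s₁ = zigzag x (≤-trans 1≤s₀ s₀≤x) (≤-trans x≤s₁ s₁≤n)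

        hit-between : ∀ x₁ x₂ y → s₀ ≤ x₁ → x₁ ≤ s₁ → s₀ ≤ x₂ → x₂ ≤ s₁ → π̂ x₁ ≤ y → y ≤ π̂ x₂ →
                      ∃[ x ] (s₀ ≤ x × x ≤ s₁ × π̂ x ≡ y)
        hit-between x₁ x₂ y s₀≤x₁ x₁≤s₁ s₀≤x₂ x₂≤s₁ π̂x₁≤y y≤π̂x₂ = proj₂ maps y
          (≤-trans (proj₁ (π̂-range x₁ (≤-trans 1≤s₀ s₀≤x₁) (≤-trans x₁≤s₁ s₁≤n))) π̂x₁≤y)
          (≤-trans y≤π̂x₂ (proj₂ (π̂-range x₂ (≤-trans 1≤s₀ s₀≤x₂) (≤-trans x₂≤s₁ s₁≤n))))
          (≤-trans (proj₁ (proj₁ maps x₁ s₀≤x₁ x₁≤s₁)) π̂x₁≤y)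
          (≤-trans y≤π̂x₂ (proj₂ (proj₁ maps x₂ s₀≤x₂ x₂≤s₁)))

      -- Here s₀ ↦ s₀ + 1; unless s₀ + 1 ↦ s₀ + 2, the value s₀ + 2 lies in the image,
      -- yet only s₀ or s₀ + 1 could rise to it.
      all-ascents-impossible : (∀ x → s₀ ≤ x → x ≤ s₁ → Ascent π̂ x) → ⊥
      all-ascents-impossible all-up = second-step (m≤n⇒m<n∨m≡n (rises up₁))
        where
          up₀ = up (zigzag-in s₀ ≤-refl (<⇒≤ s₀<s₁)) (all-up s₀ ≤-refl (<⇒≤ s₀<s₁))
          up₁ = up (zigzag-in (suc s₀) (n≤1+n s₀) s₀<s₁) (all-up (suc s₀) (n≤1+n s₀) s₀<s₁)
          π̂s₀ : π̂ s₀ ≡ suc s₀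
          π̂s₀ with m≤n⇒m<n∨m≡n (rises up₀)
          ... | inj₂ s₀+1≡π̂s₀ = sym s₀+1≡π̂s₀
          ... | inj₁ s₀+1<π̂s₀ = ⊥-elim (skips↑ up₀ (suc s₀) ≤-refl s₀+1<π̂s₀ (all-up (suc s₀) (n≤1+n s₀) s₀<s₁))
          second-step : suc (suc s₀) < π̂ (suc s₀) ⊎ suc (suc s₀) ≡ π̂ (suc s₀) → ⊥
          second-step (inj₂ s₀+2≡π̂s₀+1) =
            no-run s₀ (1≤s₀ , subst (_≤ n) (sym s₀+2≡π̂s₀+1) (≤end up₁) , inj₁ (π̂s₀ , sym s₀+2≡π̂s₀+1))
          second-step (inj₁ s₀+2<π̂s₀+1)
            with hit-between s₀ (suc s₀) (suc (suc s₀)) ≤-refl (<⇒≤ s₀<s₁) (n≤1+n s₀) s₀<s₁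
                             (subst (_≤ suc (suc s₀)) (sym π̂s₀) (n≤1+n _)) (<⇒≤ s₀+2<π̂s₀+1)
          ... | x , s₀≤x , x≤s₁ , π̂x≡s₀+2
            with m≤n⇒m<n∨m≡n (≤-pred (subst (x <_) π̂x≡s₀+2 (all-up x s₀≤x x≤s₁)))
          ...   | inj₂ refl = <-irrefl (sym π̂x≡s₀+2) s₀+2<π̂s₀+1
          ...   | inj₁ x<s₀+1 with ≤-antisym s₀≤x (≤-pred x<s₀+1)
          ...     | refl = 1+n≢n (trans (sym π̂x≡s₀+2) π̂s₀)

      -- Here s₁ ↦ s₁ − 1; unless s₁ − 1 ↦ s₁ − 2 = r, the value r lies in the image,
      -- yet only s₁ − 1 or s₁ could fall to it.
      all-descents-impossible : (∀ x → s₀ ≤ x → x ≤ s₁ → ¬ Ascent π̂ x) → ⊥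
      all-descents-impossible all-down = second-step (m≤n⇒m<n∨m≡n (≤-pred (falls down₁)))
        where
          down₂ = down (zigzag-in s₁ (<⇒≤ s₀<s₁) ≤-refl) (all-down s₁ (<⇒≤ s₀<s₁) ≤-refl)
          down₁ = down (zigzag-in (suc r) s₀≤1+r (n≤1+n _)) (all-down (suc r) s₀≤1+r (n≤1+n _))
          π̂s₁ : π̂ s₁ ≡ suc r
          π̂s₁ with m≤n⇒m<n∨m≡n (≤-pred (falls down₂))
          ... | inj₂ π̂s₁≡r+1 = π̂s₁≡r+1
          ... | inj₁ π̂s₁<r+1 = ⊥-elim (all-down (suc r) s₀≤1+r (n≤1+n _) (skips↓ down₂ (suc r) π̂s₁<r+1 ≤-refl))
          second-step : π̂ (suc r) < r ⊎ π̂ (suc r) ≡ r → ⊥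
          second-step (inj₂ π̂r+1≡r) =
            no-run r (≤-trans (start≤ down₁) (≤-reflexive π̂r+1≡r) , s₁≤n , inj₂ (π̂s₁ , π̂r+1≡r))
          second-step (inj₁ π̂r+1<r)
            with hit-between (suc r) s₁ r s₀≤1+r (n≤1+n _) (<⇒≤ s₀<s₁) ≤-refl
                             (<⇒≤ π̂r+1<r) (subst (r ≤_) (sym π̂s₁) (n≤1+n r))
          ... | x , s₀≤x , x≤s₁ , π̂x≡r with m≤n⇒m<n∨m≡n x≤s₁
          ...   | inj₂ refl = 1+n≢n (trans (sym π̂s₁) π̂x≡r)
          ...   | inj₁ x<s₁
            with ≤-antisym (subst (_< x) π̂x≡r (falls (down (zigzag-in x s₀≤x x≤s₁) (all-down x s₀≤x x≤s₁))))
                           (≤-pred x<s₁)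
          ...     | refl = <-irrefl π̂x≡r π̂r+1<r

      -- The last descent d ≤ s₁ is an image of the segment, but the points
      -- mapped to d are neither ascents (those land on ascents or on n)
      -- nor descents (those would lie after d).
      mixed-below-n-impossible : s₁ < n →
        ¬ NoneIn (Ascent π̂) s₀ (suc s₁) → ¬ NoneIn (¬_ ∘ Ascent π̂) s₀ (suc s₁) → ⊥
      mixed-below-n-impossible s₁<n some-up some-down
        with greatest-in ascent? s₀ (suc s₁) | greatest-in (¬? ∘ ascent?) s₀ (suc s₁)
      ... | inj₁ none | _ = some-up none
      ... | _ | inj₁ none = some-down none
      ... | inj₂ (u , s₀≤u , u<s₁+1 , u↑ , after-u) | inj₂ (d , s₀≤d , d<s₁+1 , ¬d↑ , after-d)
        with hit-between d u d s₀≤d (≤-pred d<s₁+1) s₀≤u (≤-pred u<s₁+1)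
                         (<⇒≤ (falls d↓)) (≤-trans (≤-pred d<s₁+1) (<⇒≤ s₁<π̂u))
        where
          d↓ = down (zigzag-in d s₀≤d (≤-pred d<s₁+1)) ¬d↑
          u↑′ = up (zigzag-in u s₀≤u (≤-pred u<s₁+1)) u↑
          s₁<π̂u : s₁ < π̂ u
          s₁<π̂u with s₁ <? π̂ u
          ... | yes s₁<π̂u = s₁<π̂u
          ... | no s₁≮π̂u with lands↑ u↑′
          ...   | inj₁ π̂u↑  = ⊥-elim (after-u (π̂ u) (rises u↑′) (s≤s (≮⇒≥ s₁≮π̂u)) π̂u↑)
          ...   | inj₂ π̂u≡n = ⊥-elim (<⇒≱ s₁<n (subst (_≤ s₁) π̂u≡n (≮⇒≥ s₁≮π̂u)))
      ...   | x , s₀≤x , x≤s₁ , π̂x≡d with ascent? x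
      ...     | no ¬x↑ = after-d x (subst (_< x) π̂x≡d (falls (down (zigzag-in x s₀≤x x≤s₁) ¬x↑))) (s≤s x≤s₁) ¬x↑
      ...     | yes x↑ with lands↑ (up (zigzag-in x s₀≤x x≤s₁) x↑)
      ...       | inj₁ π̂x↑  = ¬d↑ (subst (Ascent π̂) π̂x≡d π̂x↑)
      ...       | inj₂ π̂x≡n = <⇒≱ s₁<n (subst (_≤ s₁) (trans (sym π̂x≡d) π̂x≡n) (≤-pred d<s₁+1))

      -- Symmetrically, the first ascent u ≥ s₀ is an image of the segment.
      mixed-above-1-impossible : 1 < s₀ →
        ¬ NoneIn (Ascent π̂) s₀ (suc s₁) → ¬ NoneIn (¬_ ∘ Ascent π̂) s₀ (suc s₁) → ⊥
      mixed-above-1-impossible 1<s₀ some-up some-down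
        with least-in ascent? s₀ (suc s₁) | least-in (¬? ∘ ascent?) s₀ (suc s₁)
      ... | inj₁ none | _ = some-up none
      ... | _ | inj₁ none = some-down none
      ... | inj₂ (u , s₀≤u , u<s₁+1 , u↑ , before-u) | inj₂ (d , s₀≤d , d<s₁+1 , ¬d↑ , before-d)
        with hit-between d u u s₀≤d (≤-pred d<s₁+1) s₀≤u (≤-pred u<s₁+1)
                         (<⇒≤ (<-≤-trans π̂d<s₀ s₀≤u)) (<⇒≤ (rises u↑′))
        where
          d↓ = down (zigzag-in d s₀≤d (≤-pred d<s₁+1)) ¬d↑
          u↑′ = up (zigzag-in u s₀≤u (≤-pred u<s₁+1)) u↑
          π̂d<s₀ : π̂ d < s₀
          π̂d<s₀ with π̂ d <? s₀
          ... | yes π̂d<s₀ = π̂d<s₀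
          ... | no π̂d≮s₀ with lands↓ d↓
          ...   | inj₁ ¬π̂d↑ = ⊥-elim (before-d (π̂ d) (≮⇒≥ π̂d≮s₀) (falls d↓) ¬π̂d↑)
          ...   | inj₂ π̂d≡1 = ⊥-elim (<⇒≱ 1<s₀ (subst (s₀ ≤_) π̂d≡1 (≮⇒≥ π̂d≮s₀)))
      ...   | x , s₀≤x , x≤s₁ , π̂x≡u with ascent? x
      ...     | yes x↑ = before-u x s₀≤x (subst (x <_) π̂x≡u x↑) x↑
      ...     | no ¬x↑ with lands↓ (down (zigzag-in x s₀≤x x≤s₁) ¬x↑)
      ...       | inj₁ ¬π̂x↑ = ¬π̂x↑ (subst (Ascent π̂) (sym π̂x≡u) u↑)
      ...       | inj₂ π̂x≡1 = <⇒≱ 1<s₀ (subst (s₀ ≤_) (trans (sym π̂x≡u) π̂x≡1) s₀≤u)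

    no-proper-image : ∀ {s₀ s₁ a b} → 1 ≤ s₀ → s₀ < s₁ → s₁ ≤ n → ¬ (s₀ ≡ 1 × s₁ ≡ n) → ¬ MapsOnto s₀ s₁ a b
    no-proper-image {suc _} {suc zero} _ (s≤s ())
    no-proper-image {s₀} {s₁@(suc (suc r))} 1≤s₀ (s≤s s₀≤1+r) s₁≤n not-full maps
      with least-in (¬? ∘ ascent?) s₀ (suc s₁) | least-in ascent? s₀ (suc s₁)
    ... | inj₁ no-descent | _ = all-ascents-impossible 1≤s₀ s₀≤1+r s₁≤n maps
      (λ x s₀≤x x≤s₁ → decidable-stable (ascent? x) (no-descent x s₀≤x (s≤s x≤s₁)))
    ... | _ | inj₁ no-ascent = all-descents-impossible 1≤s₀ s₀≤1+r s₁≤n maps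
      (λ x s₀≤x x≤s₁ → no-ascent x s₀≤x (s≤s x≤s₁))
    ... | inj₂ (d , s₀≤d , d<s₁+1 , ¬d↑ , _) | inj₂ (u , s₀≤u , u<s₁+1 , u↑ , _) with s₁ <? n
    ...   | yes s₁<n = mixed-below-n-impossible 1≤s₀ s₀≤1+r s₁≤n maps s₁<n some-up some-down
      where
        some-up   = λ none → none u s₀≤u u<s₁+1 u↑
        some-down = λ none → none d s₀≤d d<s₁+1 ¬d↑
    ...   | no s₁≮n = mixed-above-1-impossible 1≤s₀ s₀≤1+r s₁≤n maps 1<s₀ some-up some-down
      where
        some-up   = λ none → none u s₀≤u u<s₁+1 u↑
        some-down = λ none → none d s₀≤d d<s₁+1 ¬d↑
        1<s₀ : 1 < s₀
        1<s₀ = ≤∧≢⇒< 1≤s₀ (λ 1≡s₀ → not-full (sym 1≡s₀ , ≤-antisym s₁≤n (≮⇒≥ s₁≮n)))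

    segment-simple : InsS π
    segment-simple (s₀ , s₁ , 1≤s₀ , _ , s₁≤n , 1<size , size<n , image)
      with imageIsSegment⇒mapsOnto 1≤s₀ s₁≤n image
    ... | _ , _ , maps = no-proper-image 1≤s₀ (1<1+j∸i⇒i<j s₀ s₁ 1<size) s₁≤n not-full maps
      where
        not-full : ¬ (s₀ ≡ 1 × s₁ ≡ n)
        not-full (refl , refl) = <-irrefl refl size<n

proposition4p3 : ∀ (m : ℕ) → 2 ≤ m → (π : Permutation′ (suc m)) →
    (InbS π × InsS π) ⇔ (IsNCycle π × Unimodal π × ¬ ContainsThreeConsecutive π)
proposition4p3 m 2≤m π = mk⇔ to from
  where
    open OnNumbers π

    1≤m : 1 ≤ m
    1≤m = <⇒≤ 2≤m

    to : InbS π × InsS π → IsNCycle π × Unimodal π × ¬ ContainsThreeConsecutive π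
    to (in-bS , in-sS) = ncycle , unimodal , λ three → in-sS (run⇒proper 2≤m (proj₂ (contains-three⇒run three)))
      where open ToUnimodalCycle (bS∧sS⇒zigzag 2≤m in-bS in-sS)

    from : IsNCycle π × Unimodal π × ¬ ContainsThreeConsecutive π → InbS π × InsS π
    from (ncycle , unimodal , no-three) =
      zigzag⇒bS 1≤m zigzag , SegmentSimple.segment-simple zigzag (λ _ run → no-three (run⇒contains-three ncycle run))
      where open FromUnimodalCycle 1≤m ncycle unimodal using (zigzag)
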